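{- For even $n$, the deterministic query complexity of $\textsc{1-vs-2-Cycle}$ on $n$ vertices satisfies $D(\textsc{1-vs-2-Cycle})\ge\frac{n^2}{512}$.
   Context: Graphs on $n$ vertices are encoded by adjacency matrix bits, i.e. as strings in $\{0,1\}^N$, $N=\binom n2$. $\textsc{1-vs-2-Cycle}:\Delta\to\{0,1\}$ is the partial Boolean function whose domain $\Delta$ consists of all $n$-vertex graphs that are a single cycle of length $n$ (value $1$) or two disjoint cycles each of length $n/2$ (value $0$). For a partial $g:\Delta\to\{0,1\}$, $D(g)$ is the minimum, over all total $f:\{0,1\}^N\to\{0,1\}$ agreeing with $g$ on $\Delta$, of the minimum depth of a deterministic decision tree (querying input bits) computing $f$. -}

module Defs where

open import Data.Bool using (Bool; true; false)
open import Data.Nat using (ℕ; zero; suc; _+_; _<_)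
open import Data.Fin using (Fin; toℕ; _<?_)
import Data.Fin as F
open import Data.Product using (Σ; Σ-syntax; _×_; _,_)
open import Data.Sum using (_⊎_)
open import Relation.Nullary using (yes; no)
open import Relation.Binary.PropositionalEquality using (_≡_)
open import Function.Definitions using (Injective)
open import Function.Bundles using (_⇔_)

-- Potential edges of a simple graph on vertex set Fin n: unordered pairs {i,j},
-- encoded canonically as (i , j , i < j).  There are exactly (n choose 2) of them,
-- so  Edge n → Bool  is the set {0,1}^N of adjacency-matrix bit strings.
Edge : ℕ → Set
Edge n = Σ[ i ∈ Fin n ] Σ[ j ∈ Fin n ] (i F.< j)

Graph : ℕ → Set
Graph n = Edge n → Bool

adj : ∀ {n} → Graph n → Fin n → Fin n → Bool
adj G u w with u <? w | w <? u
... | yes u<w | _ = G (u , w , u<w)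
... | no _ | yes w<u = G (w , u , w<u)
... | no _ | no _ = false

-- Step L off i j : index j follows index i on the cyclic sequence
-- off, off+1, ..., off+L-1 (with off+L-1 followed by off).
data Step (L off : ℕ) : ℕ → ℕ → Set where
  inner : ∀ a → suc a < L → Step L off (off + a) (off + suc a)
  wrap  : ∀ a → suc a ≡ L → Step L off (off + a) off

EdgesAre : ∀ {n} → Graph n → (Fin n → Fin n) → (ℕ → ℕ → Set) → Set
EdgesAre {n} G v S =
  ∀ u w → (adj G u w ≡ true) ⇔
    (Σ[ i ∈ Fin n ] Σ[ j ∈ Fin n ]
       (S (toℕ i) (toℕ j) × ((u ≡ v i × w ≡ v j) ⊎ (u ≡ v j × w ≡ v i))))

IsOneCycle : ∀ {n} → Graph n → Set
IsOneCycle {n} G =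
  Σ[ v ∈ (Fin n → Fin n) ] (Injective _≡_ _≡_ v × EdgesAre G v (Step n 0))

IsTwoCycles : ∀ {n} → (m : ℕ) → Graph n → Set
IsTwoCycles {n} m G =
  Σ[ v ∈ (Fin n → Fin n) ]
    (Injective _≡_ _≡_ v ×
     EdgesAre G v (λ i j → Step m 0 i j ⊎ Step m m i j))

data DTree (Q : Set) : Set where
  leaf : Bool → DTree Q
  node : Q → DTree Q → DTree Q → DTree Q   -- query q: left if bit false, right if true

eval : ∀ {Q} → DTree Q → (Q → Bool) → Bool
eval (leaf b) x = b
eval (node q l r) x with x q
... | false = eval l x
... | true  = eval r x

depth : ∀ {Q} → DTree Q → ℕ
depth (leaf _) = 0
depth (node _ l r) = suc (Data.Nat._⊔_ (depth l) (depth r))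
  where import Data.Nat

-- A total function f extends the partial function 1-vs-2-Cycle (n = m + m).
Extends1vs2 : ∀ {n} (m : ℕ) → (Graph n → Bool) → Set
Extends1vs2 {n} m f =
  (∀ G → IsOneCycle G → f G ≡ true) × (∀ G → IsTwoCycles m G → f G ≡ false)

Computes : ∀ {Q} → DTree Q → ((Q → Bool) → Bool) → Set
Computes T f = ∀ x → eval T x ≡ f x

module Submission where

-- An adversary answers the queries so that the edges answered 1 form vertex-disjoint paths covering
-- all vertices.  A query {a,b} between ends of two different paths is answered 1 (joining them) when
-- a or b is heavy, i.e. already has t "forbidden" partners; otherwise it is answered 0 and {a,b} is
-- recorded as forbidden, so forbidden degrees never exceed t.  Every path edge then has a heavy end,
-- so after D queries at most 3·#heavy ≤ 6D/t vertices lie on non-trivial paths.  While this is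
-- below m − 4t the singleton paths leave enough room to link all paths greedily, avoiding forbidden
-- pairs, both into one Hamiltonian cycle and into two cycles of length m = n/2.  Both graphs agree
-- with every answer, so the tree cannot separate them; t ≈ m/8 yields D ≥ m²/128 = n²/512.

open import Defs
open import Data.Bool using (Bool; true; false; if_then_else_)
open import Data.Nat using (ℕ; zero; suc; _+_; _*_; _∸_; _<_; _≤_; z≤n; s≤s; s≤s⁻¹; _⊔_; _≤?_; >-nonZero)
open import Data.Nat.Properties
import Data.Nat as ℕ
open import Data.Nat.DivMod using (_/_; _%_; m≡m%n+[m/n]*n; m%n<n; /-monoˡ-≤)
open import Data.Nat.Tactic.RingSolver using (solve-∀)
open import Algebra.Properties.CommutativeSemigroup +-commutativeSemigroup using (interchange)
open import Algebra.Properties.CommutativeSemigroup *-commutativeSemigroup using () renaming (x∙yz≈y∙xz to *-exchange)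
open import Data.Fin as Fin using (Fin; toℕ; fromℕ<)
import Data.Fin.Properties as Finₚ
open import Data.List using (List; []; _∷_; _++_; length; [_]; lookup; map; concat; reverse; allFin; filter; take; drop)
import Data.List.Properties as Listₚ
open import Data.List.Relation.Unary.All as All using (All; []; _∷_)
open import Data.List.Relation.Unary.AllPairs using ([]; _∷_)
import Data.List.Relation.Unary.All.Properties as Allₚ
open import Data.List.Relation.Unary.Any as Any using (Any; here; there)
open import Data.List.Membership.Propositional using (_∈_; find; lose)
open import Data.List.Membership.Propositional.Properties
  using (∈-map⁻; ∈-concat⁺′; ∈-concat⁻′; ∈-++⁺ˡ; ∈-++⁺ʳ; ∈-++⁻; ∈-allFin)
open import Data.List.Relation.Binary.Permutation.Propositional as ↭ using (_↭_; ↭-sym)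
import Data.List.Relation.Binary.Permutation.Propositional.Properties as ↭ₚ
open import Data.List.Relation.Unary.Unique.Propositional using (Unique)
open import Data.List.Relation.Unary.Unique.Propositional.Properties using (allFin⁺)
import Data.Product
open import Data.Product.Properties using (≡-dec)
open import Data.Product using (Σ-syntax; ∃₂; _×_; _,_; proj₁; proj₂)
open import Data.Sum using (_⊎_; inj₁; inj₂)
import Data.Sum
open import Data.Empty using (⊥; ⊥-elim)
open import Relation.Nullary using (¬_; Dec; yes; no; contradiction)
open import Relation.Nullary.Decidable using (isYes; _⊎-dec_; _×-dec_)
open import Relation.Binary.Definitions using (DecidableEquality)
open import Relation.Unary using (∁)
open import Relation.Unary.Properties using (∁?)
open import Relation.Binary.PropositionalEquality
  using (_≡_; _≢_; refl; sym; trans; cong; cong₂; subst; subst₂; setoid; module ≡-Reasoning)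
open import Function.Base using (_∘_)
open import Function.Bundles using (_⇔_; mk⇔; Equivalence)
open import Function.Properties.Equivalence using () renaming (trans to ⇔-trans)

private
  variable
    A : Set
    n : ℕ

data Consec {A : Set} : List A → A → A → Set where
  here  : ∀ {x y ys} → Consec (x ∷ y ∷ ys) x y
  there : ∀ {z x y ys} → Consec ys x y → Consec (z ∷ ys) x y

data At {A : Set} : List A → ℕ → A → Set where
  here  : ∀ {x xs} → At (x ∷ xs) 0 x
  there : ∀ {x xs k y} → At xs k y → At (x ∷ xs) (suc k) y

module _ {A : Set} where

  At-< : ∀ {xs : List A} {k x} → At xs k x → k < length xs
  At-< here = s≤s z≤n
  At-< (there p) = s≤s (At-< p)

  At-functional : ∀ {xs : List A} {k x y} → At xs k x → At xs k y → x ≡ y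
  At-functional here here = refl
  At-functional (there p) (there q) = At-functional p q

  All-At : ∀ {P : A → Set} {xs k x} → All P xs → At xs k x → P x
  All-At (px ∷ _) here = px
  All-At (_ ∷ ps) (there q) = All-At ps q

  At-injective : ∀ {xs : List A} {k j x} → Unique xs → At xs k x → At xs j x → k ≡ j
  At-injective _ here here = refl
  At-injective (x∉ ∷ _) here (there q) = ⊥-elim (All-At x∉ q refl)
  At-injective (x∉ ∷ _) (there p) here = ⊥-elim (All-At x∉ p refl)
  At-injective (_ ∷ u) (there p) (there q) = cong suc (At-injective u p q)

  At-lookup : ∀ (xs : List A) i → At xs (toℕ i) (lookup xs i)
  At-lookup (x ∷ xs) Fin.zero = here
  At-lookup (x ∷ xs) (Fin.suc i) = there (At-lookup xs i)

  At-++ˡ : ∀ {xs ys : List A} {k x} → At xs k x → At (xs ++ ys) k x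
  At-++ˡ here = here
  At-++ˡ (there p) = there (At-++ˡ p)

  At-++ʳ : ∀ (xs : List A) {ys k x} → At ys k x → At (xs ++ ys) (length xs + k) x
  At-++ʳ [] p = p
  At-++ʳ (_ ∷ xs) p = there (At-++ʳ xs p)

  At-++⁻ : ∀ (xs : List A) {ys k x} → At (xs ++ ys) k x →
           At xs k x ⊎ Σ[ j ∈ ℕ ] (k ≡ length xs + j × At ys j x)
  At-++⁻ [] p = inj₂ (_ , refl , p)
  At-++⁻ (_ ∷ xs) here = inj₁ here
  At-++⁻ (_ ∷ xs) (there p) with At-++⁻ xs p
  ... | inj₁ q = inj₁ (there q)
  ... | inj₂ (j , refl , q) = inj₂ (j , refl , q)

  At-segment : ∀ (pre : List A) {L post k x} → k < length L →
               At (pre ++ L ++ post) (length pre + k) x → At L k x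
  At-segment pre {L} {k = k} k<L p with At-++⁻ pre p
  ... | inj₁ q = contradiction (At-< q) (m+n≮m (length pre) k)
  ... | inj₂ (j , e , q) with At-++⁻ L (subst (λ i → At _ i _) (sym (+-cancelˡ-≡ (length pre) k j e)) q)
  ...   | inj₁ r = r
  ...   | inj₂ (i , refl , _) = contradiction k<L (m+n≮m (length L) i)

  At-snoc : ∀ (xs : List A) {z} → At (xs ++ [ z ]) (length xs) z
  At-snoc xs {z} = subst (λ i → At (xs ++ [ z ]) i z) (+-identityʳ (length xs)) (At-++ʳ xs here)

  At-snoc⁻ : ∀ (xs : List A) {z k x} → At (xs ++ [ z ]) k x → At xs k x ⊎ (k ≡ length xs × x ≡ z)
  At-snoc⁻ xs p with At-++⁻ xs p
  ... | inj₁ q = inj₁ q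
  ... | inj₂ (.0 , e , here) = inj₂ (trans e (+-identityʳ (length xs)) , refl)

  Consec⇒At : ∀ {xs : List A} {x y} → Consec xs x y → Σ[ k ∈ ℕ ] (At xs k x × At xs (suc k) y)
  Consec⇒At here = 0 , here , there here
  Consec⇒At (there c) with Consec⇒At c
  ... | k , p , q = suc k , there p , there q

  At⇒Consec : ∀ {xs : List A} {k x y} → At xs k x → At xs (suc k) y → Consec xs x y
  At⇒Consec here (there here) = here
  At⇒Consec (there p) (there q) = there (At⇒Consec p q)

  consec? : DecidableEquality A → ∀ xs (x y : A) → Dec (Consec xs x y)
  consec? _≟_ [] x y = no λ ()
  consec? _≟_ (z ∷ []) x y = no λ { (there ()) }
  consec? _≟_ (z ∷ w ∷ ys) x y with z ≟ x | w ≟ y | consec? _≟_ (w ∷ ys) x y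
  ... | yes refl | yes refl | _ = yes here
  ... | _ | _ | yes c = yes (there c)
  ... | no z≢x | _ | no ¬c = no λ { here → z≢x refl ; (there c) → ¬c c }
  ... | yes _ | no w≢y | no ¬c = no λ { here → w≢y refl ; (there c) → ¬c c }

Unique-++⁻ : ∀ (xs : List A) {ys} → Unique (xs ++ ys) → Unique xs × Unique ys
Unique-++⁻ [] u = [] , u
Unique-++⁻ (x ∷ xs) (x∉ ∷ u) = (Allₚ.++⁻ˡ xs x∉ ∷ proj₁ (Unique-++⁻ xs u)) , proj₂ (Unique-++⁻ xs u)

closeCycle : List A → List A
closeCycle [] = []
closeCycle (h ∷ t) = h ∷ t ++ [ h ]

closeCycle-∈ : ∀ {L : List A} {x} → x ∈ closeCycle L → x ∈ L
closeCycle-∈ {L = h ∷ t} (here refl) = here refl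
closeCycle-∈ {L = h ∷ t} (there x∈) with ∈-++⁻ t x∈
... | inj₁ x∈t = there x∈t
... | inj₂ (here refl) = here refl

CycleAdj : List A → A → A → Set
CycleAdj L x y = Consec (closeCycle L) x y ⊎ Consec (closeCycle L) y x

shiftStep : ∀ {K off a b} → Step K 0 a b → Step K off (off + a) (off + b)
shiftStep (inner a p) = inner a p
shiftStep {off = off} (wrap a p) = subst (Step _ off (off + a)) (sym (+-identityʳ off)) (wrap a p)

unshiftStep : ∀ {K off i j} → Step K off i j →
              Σ[ a ∈ ℕ ] Σ[ b ∈ ℕ ] (i ≡ off + a × j ≡ off + b × Step K 0 a b)
unshiftStep (inner a p) = a , suc a , refl , refl , inner a p
unshiftStep {off = off} (wrap a p) = a , 0 , refl , sym (+-identityʳ off) , wrap a p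

Step-bounded : ∀ {K a b} → Step K 0 a b → a < K × b < K
Step-bounded (inner a p) = <-trans (n<1+n a) p , p
Step-bounded (wrap a refl) = n<1+n a , s≤s z≤n

Step-irreflexive : ∀ {K a} → 2 ≤ K → ¬ Step K 0 a a
Step-irreflexive (s≤s ()) (wrap 0 refl)

module _ {A : Set} where

  closeCycle⇒Step : ∀ (L : List A) {x y} → Consec (closeCycle L) x y →
                    ∃₂ λ a b → Step (length L) 0 a b × At L a x × At L b y
  closeCycle⇒Step [] ()
  closeCycle⇒Step L@(h ∷ t) c with Consec⇒At c
  ... | k , p , q with At-snoc⁻ L p | At-snoc⁻ L q
  ... | inj₂ (refl , _) | _ =
    contradiction (subst (suc (length L) <_) (trans (Listₚ.length-++ L) (+-comm (length L) 1)) (At-< q)) (<-irrefl refl)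
  ... | inj₁ p′ | inj₁ q′ = k , suc k , inner k (At-< q′) , p′ , q′
  ... | inj₁ p′ | inj₂ (e , refl) = k , 0 , wrap k e , p′ , here

  Step⇒closeCycle : ∀ (L : List A) {a b x y} → Step (length L) 0 a b → At L a x → At L b y →
                    Consec (closeCycle L) x y
  Step⇒closeCycle [] st ()
  Step⇒closeCycle L@(h ∷ t) (inner a _) p q = At⇒Consec (At-++ˡ p) (At-++ˡ q)
  Step⇒closeCycle L@(h ∷ t) (wrap a e) p here =
    At⇒Consec (At-++ˡ p) (subst (λ i → At (L ++ [ h ]) i h) (sym e) (At-snoc L))

-- Graphs defined by cycles

isYes⇔ : ∀ {P : Set} (d : Dec P) → (isYes d ≡ true) ⇔ P
isYes⇔ (yes p) = mk⇔ (λ _ → p) (λ _ → refl)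
isYes⇔ (no ¬p) = mk⇔ (λ ()) (λ p → contradiction p ¬p)

graphOf : {R : Fin n → Fin n → Set} → (∀ u w → Dec (R u w)) → Graph n
graphOf R? (u , w , _) = isYes (R? u w)

adj-graphOf : ∀ {R : Fin n → Fin n → Set} (R? : ∀ u w → Dec (R u w)) →
              (∀ {u w} → R u w → R w u) → (∀ {u} → ¬ R u u) →
              ∀ u w → (adj (graphOf R?) u w ≡ true) ⇔ R u w
adj-graphOf R? R-sym R-irr u w with u Fin.<? w | w Fin.<? u
... | yes _ | _ = isYes⇔ (R? u w)
... | no _ | yes _ = mk⇔ (R-sym ∘ Equivalence.to (isYes⇔ (R? w u))) (Equivalence.from (isYes⇔ (R? w u)) ∘ R-sym)
... | no u≮w | no w≮u with Finₚ.toℕ-injective (≤-antisym (≮⇒≥ w≮u) (≮⇒≥ u≮w))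
...   | refl = mk⇔ (λ ()) (λ r → contradiction r R-irr)

EdgeOf : (Fin n → Fin n) → (ℕ → ℕ → Set) → Fin n → Fin n → Set
EdgeOf {n} v S u w =
  Σ[ i ∈ Fin n ] Σ[ j ∈ Fin n ] (S (toℕ i) (toℕ j) × ((u ≡ v i × w ≡ v j) ⊎ (u ≡ v j × w ≡ v i)))

EdgeOf-⊎ : ∀ (v : Fin n → Fin n) S S′ u w →
           (EdgeOf v S u w ⊎ EdgeOf v S′ u w) ⇔ EdgeOf v (λ i j → S i j ⊎ S′ i j) u w
EdgeOf-⊎ v S S′ u w = mk⇔
  (λ { (inj₁ (i , j , s , o)) → i , j , inj₁ s , o ; (inj₂ (i , j , s , o)) → i , j , inj₂ s , o })
  (λ { (i , j , inj₁ s , o) → inj₁ (i , j , s , o) ; (i , j , inj₂ s , o) → inj₂ (i , j , s , o) })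

module Enumeration (W : List (Fin n)) (len : length W ≡ n) where

  vertex : Fin n → Fin n
  vertex i = lookup W (Fin.cast (sym len) i)

  At-vertex : ∀ i → At W (toℕ i) (vertex i)
  At-vertex i = subst (λ k → At W k (vertex i)) (Finₚ.toℕ-cast (sym len) i) (At-lookup W _)

  position : ∀ {k x} → At W k x → Σ[ i ∈ Fin n ] (toℕ i ≡ k × vertex i ≡ x)
  position {k} p =
    i , Finₚ.toℕ-fromℕ< k<n , At-functional (At-vertex i) (subst (λ j → At W j _) (sym (Finₚ.toℕ-fromℕ< k<n)) p)
    where
    k<n = subst (k <_) len (At-< p)
    i = fromℕ< k<n

  vertex-injective : Unique W → ∀ {i j} → vertex i ≡ vertex j → i ≡ j
  vertex-injective u {i} {j} e = Finₚ.toℕ-injective (At-injective u (At-vertex i) (subst (At W (toℕ j)) (sym e) (At-vertex j)))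

  module _ (pre L post : List (Fin n)) (split : W ≡ pre ++ L ++ post) where

    private
      K = length L
      off = length pre

    closeCycle⇒EdgeStep : ∀ {x y} → Consec (closeCycle L) x y →
                          Σ[ i ∈ Fin n ] Σ[ j ∈ Fin n ] (Step K off (toℕ i) (toℕ j) × x ≡ vertex i × y ≡ vertex j)
    closeCycle⇒EdgeStep c with closeCycle⇒Step L c
    ... | a , b , st , p , q with position (inSegment p) | position (inSegment q)
      where
      inSegment : ∀ {k z} → At L k z → At W (off + k) z
      inSegment r = subst (λ X → At X _ _) (sym split) (At-++ʳ pre (At-++ˡ r))
    ... | i , ei , vi | j , ej , vj = i , j , subst₂ (Step K off) (sym ei) (sym ej) (shiftStep st) , sym vi , sym vj

    EdgeStep⇒closeCycle : ∀ {i j} → Step K off (toℕ i) (toℕ j) → Consec (closeCycle L) (vertex i) (vertex j)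
    EdgeStep⇒closeCycle {i} {j} st with unshiftStep st
    ... | a , b , ei , ej , st₀ = Step⇒closeCycle L st₀ (fromSegment (proj₁ (Step-bounded st₀)) ei (At-vertex i))
                                                         (fromSegment (proj₂ (Step-bounded st₀)) ej (At-vertex j))
      where
      fromSegment : ∀ {k c z} → c < K → k ≡ off + c → At W k z → At L c z
      fromSegment c<K e r = At-segment pre c<K (subst₂ (λ X i → At X i _) split e r)

    CycleAdj⇔EdgeOf : ∀ u w → CycleAdj L u w ⇔ EdgeOf vertex (Step K off) u w
    CycleAdj⇔EdgeOf u w = mk⇔ to from
      where
      to : CycleAdj L u w → EdgeOf vertex (Step K off) u w
      to (inj₁ c) with closeCycle⇒EdgeStep c
      ... | i , j , st , refl , refl = i , j , st , inj₁ (refl , refl)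
      to (inj₂ c) with closeCycle⇒EdgeStep c
      ... | i , j , st , refl , refl = i , j , st , inj₂ (refl , refl)
      from : EdgeOf vertex (Step K off) u w → CycleAdj L u w
      from (i , j , st , inj₁ (refl , refl)) = inj₁ (EdgeStep⇒closeCycle st)
      from (i , j , st , inj₂ (refl , refl)) = inj₂ (EdgeStep⇒closeCycle st)

CycleAdj-sym : ∀ {L : List A} {x y} → CycleAdj L x y → CycleAdj L y x
CycleAdj-sym (inj₁ c) = inj₂ c
CycleAdj-sym (inj₂ c) = inj₁ c

CycleAdj-irreflexive : ∀ {L : List A} → Unique L → 2 ≤ length L → ∀ {x} → ¬ CycleAdj L x x
CycleAdj-irreflexive {L = L} u two (inj₁ c) = irr c
  where
  irr : ∀ {x} → ¬ Consec (closeCycle L) x x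
  irr c with closeCycle⇒Step L c
  ... | a , b , st , p , q with At-injective u p q
  ... | refl = Step-irreflexive two st
CycleAdj-irreflexive u two (inj₂ c) = CycleAdj-irreflexive u two (inj₁ c)

CycleAdj? : ∀ (L : List (Fin n)) u w → Dec (CycleAdj L u w)
CycleAdj? L u w = consec? Fin._≟_ (closeCycle L) u w ⊎-dec consec? Fin._≟_ (closeCycle L) w u

cycleGraph : List (Fin n) → Graph n
cycleGraph L = graphOf (CycleAdj? L)

adj-cycleGraph : ∀ {L : List (Fin n)} → Unique L → 2 ≤ length L →
                 ∀ u w → (adj (cycleGraph L) u w ≡ true) ⇔ CycleAdj L u w
adj-cycleGraph {L = L} u two = adj-graphOf (CycleAdj? L) CycleAdj-sym (CycleAdj-irreflexive u two)

isOneCycle-cycleGraph : ∀ (L : List (Fin n)) → length L ≡ n → Unique L → 2 ≤ n → IsOneCycle (cycleGraph L)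
isOneCycle-cycleGraph {n} L len u two = vertex , vertex-injective u , edges
  where
  open Enumeration L len
  edges : EdgesAre (cycleGraph L) vertex (Step n 0)
  edges x y = ⇔-trans (adj-cycleGraph u (subst (2 ≤_) (sym len) two) x y)
                (subst (λ K → CycleAdj L x y ⇔ EdgeOf vertex (Step K 0) x y) len
                  (CycleAdj⇔EdgeOf [] L [] (sym (Listₚ.++-identityʳ L)) x y))

TwoCycleAdj : List A → List A → A → A → Set
TwoCycleAdj L₁ L₂ x y = CycleAdj L₁ x y ⊎ CycleAdj L₂ x y

twoCycleGraph : List (Fin n) → List (Fin n) → Graph n
twoCycleGraph L₁ L₂ = graphOf (λ u w → CycleAdj? L₁ u w ⊎-dec CycleAdj? L₂ u w)

adj-twoCycleGraph : ∀ {L₁ L₂ : List (Fin n)} → Unique (L₁ ++ L₂) → 2 ≤ length L₁ → 2 ≤ length L₂ →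
                    ∀ u w → (adj (twoCycleGraph L₁ L₂) u w ≡ true) ⇔ TwoCycleAdj L₁ L₂ u w
adj-twoCycleGraph {L₁ = L₁} {L₂} u two₁ two₂ = adj-graphOf _ sym′ irr
  where
  sym′ : ∀ {x y} → TwoCycleAdj L₁ L₂ x y → TwoCycleAdj L₁ L₂ y x
  sym′ = Data.Sum.map CycleAdj-sym CycleAdj-sym
  irr : ∀ {x} → ¬ TwoCycleAdj L₁ L₂ x x
  irr (inj₁ c) = CycleAdj-irreflexive (proj₁ (Unique-++⁻ L₁ u)) two₁ c
  irr (inj₂ c) = CycleAdj-irreflexive (proj₂ (Unique-++⁻ L₁ u)) two₂ c

isTwoCycles-twoCycleGraph : ∀ {m} (L₁ L₂ : List (Fin n)) → length L₁ ≡ m → length L₂ ≡ m → n ≡ m + m →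
                            Unique (L₁ ++ L₂) → 2 ≤ m → IsTwoCycles m (twoCycleGraph L₁ L₂)
isTwoCycles-twoCycleGraph {n} {m} L₁ L₂ l₁ l₂ n≡ u two = vertex , vertex-injective u , edges
  where
  len : length (L₁ ++ L₂) ≡ n
  len = trans (Listₚ.length-++ L₁) (trans (cong₂ _+_ l₁ l₂) (sym n≡))
  open Enumeration (L₁ ++ L₂) len
  edges : EdgesAre (twoCycleGraph L₁ L₂) vertex (λ i j → Step m 0 i j ⊎ Step m m i j)
  edges x y = ⇔-trans (adj-twoCycleGraph u (subst (2 ≤_) (sym l₁) two) (subst (2 ≤_) (sym l₂) two) x y)
                (⇔-trans (mk⇔ (Data.Sum.map (Equivalence.to first) (Equivalence.to second))
                              (Data.Sum.map (Equivalence.from first) (Equivalence.from second)))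
                  (EdgeOf-⊎ vertex (Step m 0) (Step m m) x y))
    where
    first : CycleAdj L₁ x y ⇔ EdgeOf vertex (Step m 0) x y
    first = subst (λ K → CycleAdj L₁ x y ⇔ EdgeOf vertex (Step K 0) x y) l₁
              (CycleAdj⇔EdgeOf [] L₁ L₂ refl x y)
    second : CycleAdj L₂ x y ⇔ EdgeOf vertex (Step m m) x y
    second = subst₂ (λ K o → CycleAdj L₂ x y ⇔ EdgeOf vertex (Step K o) x y) l₂ l₁
               (CycleAdj⇔EdgeOf L₁ L₂ [] (cong (L₁ ++_) (sym (Listₚ.++-identityʳ L₂))) x y)

indicator : {P : Set} → Dec P → ℕ
indicator (yes _) = 1
indicator (no _) = 0

indicator-⊎ : ∀ {P Q R : Set} → (P → Q ⊎ R) → (p : Dec P) (q : Dec Q) (r : Dec R) →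
              indicator p ≤ indicator q + indicator r
indicator-⊎ split (no _) _ _ = z≤n
indicator-⊎ split (yes _) (yes _) _ = s≤s z≤n
indicator-⊎ split (yes _) (no _) (yes _) = s≤s z≤n
indicator-⊎ split (yes p) (no ¬q) (no ¬r) = Data.Sum.[ (λ q → contradiction q ¬q) , (λ r → contradiction r ¬r) ] (split p)

module _ {A : Set} where

  count : {P : A → Set} → (∀ x → Dec (P x)) → List A → ℕ
  count P? [] = 0
  count P? (x ∷ xs) = indicator (P? x) + count P? xs

  count-mono : ∀ {P Q : A → Set} (P? : ∀ x → Dec (P x)) (Q? : ∀ x → Dec (Q x)) →
               (∀ {x} → P x → Q x) → ∀ xs → count P? xs ≤ count Q? xs
  count-mono P? Q? P⇒Q [] = z≤n
  count-mono {P} {Q} P? Q? P⇒Q (x ∷ xs) = +-mono-≤ (indicator-mono (P? x) (Q? x)) (count-mono P? Q? P⇒Q xs)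
    where
    indicator-mono : (p : Dec (P x)) (q : Dec (Q x)) → indicator p ≤ indicator q
    indicator-mono (yes p) (yes _) = ≤-refl
    indicator-mono (yes p) (no ¬q) = contradiction (P⇒Q p) ¬q
    indicator-mono (no _) _ = z≤n

  count-⊎ : ∀ {P Q R : A → Set} (P? : ∀ x → Dec (P x)) (Q? : ∀ x → Dec (Q x)) (R? : ∀ x → Dec (R x)) →
            (∀ {x} → P x → Q x ⊎ R x) → ∀ xs → count P? xs ≤ count Q? xs + count R? xs
  count-⊎ P? Q? R? split [] = z≤n
  count-⊎ P? Q? R? split (x ∷ xs) =
    ≤-trans (+-mono-≤ (indicator-⊎ split (P? x) (Q? x) (R? x)) (count-⊎ P? Q? R? split xs))
            (≤-reflexive (interchange (indicator (Q? x)) (indicator (R? x)) (count Q? xs) (count R? xs)))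

  count-++ : ∀ {P : A → Set} (P? : ∀ x → Dec (P x)) xs ys → count P? (xs ++ ys) ≡ count P? xs + count P? ys
  count-++ P? [] ys = refl
  count-++ P? (x ∷ xs) ys = trans (cong (indicator (P? x) +_) (count-++ P? xs ys)) (sym (+-assoc (indicator (P? x)) _ _))

  count-↭ : ∀ {P : A → Set} (P? : ∀ x → Dec (P x)) {xs ys} → xs ↭ ys → count P? xs ≡ count P? ys
  count-↭ P? ↭.refl = refl
  count-↭ P? (↭.prep x p) = cong (indicator (P? x) +_) (count-↭ P? p)
  count-↭ P? (↭.swap x y p) =
    trans (sym (+-assoc (indicator (P? x)) _ _))
      (trans (cong₂ _+_ (+-comm (indicator (P? x)) (indicator (P? y))) (count-↭ P? p)) (+-assoc (indicator (P? y)) _ _))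
  count-↭ P? (↭.trans p q) = trans (count-↭ P? p) (count-↭ P? q)

  count-none : ∀ {P : A → Set} (P? : ∀ x → Dec (P x)) {xs} → All (λ x → ¬ P x) xs → count P? xs ≡ 0
  count-none P? [] = refl
  count-none P? {x ∷ _} (¬px ∷ ¬ps) with P? x
  ... | yes px = contradiction px ¬px
  ... | no _ = count-none P? ¬ps

  count-unique≤1 : ∀ {P : A → Set} (P? : ∀ x → Dec (P x)) {c} → (∀ {x} → P x → x ≡ c) →
                   ∀ {xs} → Unique xs → count P? xs ≤ 1
  count-unique≤1 P? only [] = z≤n
  count-unique≤1 P? only {x ∷ xs} (x∉ ∷ u) with P? x
  ... | no _ = count-unique≤1 P? only u
  ... | yes px = s≤s (≤-reflexive (count-none P? (All.map (λ x≢y py → x≢y (trans (only px) (sym (only py)))) x∉)))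

  ∃-avoiding : ∀ {P Q : A → Set} (P? : ∀ x → Dec (P x)) (Q? : ∀ x → Dec (Q x)) xs →
               count P? xs + count Q? xs < length xs → Σ[ x ∈ A ] (x ∈ xs × ¬ P x × ¬ Q x)
  ∃-avoiding P? Q? (x ∷ xs) lt with P? x | Q? x
  ... | no ¬p | no ¬q = x , here refl , ¬p , ¬q
  ... | yes _ | q = Data.Product.map₂ (Data.Product.map₁ there) (∃-avoiding P? Q? xs
                      (≤-trans (s≤s (+-monoʳ-≤ (count P? xs) (m≤n+m _ (indicator q)))) (s≤s⁻¹ lt)))
  ... | no _ | yes _ = Data.Product.map₂ (Data.Product.map₁ there) (∃-avoiding P? Q? xs
                         (s≤s⁻¹ (subst (_< suc (length xs)) (+-suc (count P? xs) (count Q? xs)) lt)))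

count-map : ∀ {A B : Set} {P : B → Set} (P? : ∀ x → Dec (P x)) (f : A → B) xs →
            count P? (map f xs) ≡ count (λ x → P? (f x)) xs
count-map P? f [] = refl
count-map P? f (x ∷ xs) = cong (indicator (P? (f x)) +_) (count-map P? f xs)

sumOf : (A → ℕ) → List A → ℕ
sumOf f [] = 0
sumOf f (x ∷ xs) = f x + sumOf f xs

sumOf-+ : ∀ (f g : A → ℕ) xs → sumOf (λ x → f x + g x) xs ≡ sumOf f xs + sumOf g xs
sumOf-+ f g [] = refl
sumOf-+ f g (x ∷ xs) = trans (cong (f x + g x +_) (sumOf-+ f g xs)) (interchange (f x) (g x) (sumOf f xs) (sumOf g xs))

sumOf-indicator : ∀ {P : A → Set} (P? : ∀ x → Dec (P x)) xs → sumOf (λ x → indicator (P? x)) xs ≡ count P? xs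
sumOf-indicator P? [] = refl
sumOf-indicator P? (x ∷ xs) = cong (indicator (P? x) +_) (sumOf-indicator P? xs)

*-count≤sumOf : ∀ {P : A → Set} (P? : ∀ x → Dec (P x)) t (f : A → ℕ) → (∀ {x} → P x → t ≤ f x) →
                ∀ xs → t * count P? xs ≤ sumOf f xs
*-count≤sumOf P? t f large [] = ≤-reflexive (*-zeroʳ t)
*-count≤sumOf P? t f large (x ∷ xs) with P? x
... | yes px = ≤-trans (≤-reflexive (*-suc t (count P? xs))) (+-mono-≤ (large px) (*-count≤sumOf P? t f large xs))
... | no _ = ≤-trans (*-count≤sumOf P? t f large xs) (m≤n+m _ (f x))

↭-filter-split : ∀ {P : A → Set} (P? : ∀ x → Dec (P x)) xs → xs ↭ filter P? xs ++ filter (∁? P?) xs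
↭-filter-split {A = A} P? xs =
  subst (λ (ys , zs) → xs ↭ ys ++ zs) (Listₚ.partition-defn P? xs) (↭.↭ₛ⇒↭ (partition-↭ P? xs))
  where open import Data.List.Relation.Binary.Permutation.Setoid.Properties (setoid A) using (partition-↭)

concat-↭ : ∀ {xss yss : List (List A)} → xss ↭ yss → concat xss ↭ concat yss
concat-↭ ↭.refl = ↭.refl
concat-↭ (↭.prep xs p) = ↭ₚ.++⁺ˡ xs (concat-↭ p)
concat-↭ (↭.swap xs ys p) = ↭.trans (↭ₚ.shifts xs ys) (↭ₚ.++⁺ˡ ys (↭ₚ.++⁺ˡ xs (concat-↭ p)))
concat-↭ (↭.trans p q) = ↭.trans (concat-↭ p) (concat-↭ q)

Unique-resp-↭ : ∀ {xs ys : List A} → xs ↭ ys → Unique xs → Unique ys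
Unique-resp-↭ p = Unique-resp-↭ₛ (↭.↭⇒↭ₛ p)
  where open import Data.List.Relation.Binary.Permutation.Setoid.Properties (setoid _)
          using () renaming (Unique-resp-↭ to Unique-resp-↭ₛ)

NonEmpty : List A → Set
NonEmpty xs = 1 ≤ length xs

headOr : A → List A → A
headOr d [] = d
headOr d (x ∷ _) = x

lastOr : A → List A → A
lastOr d [] = d
lastOr d (x ∷ []) = x
lastOr d (x ∷ y ∷ ys) = lastOr d (y ∷ ys)

module _ {A : Set} where

  headOr∈ : ∀ d {xs : List A} → NonEmpty xs → headOr d xs ∈ xs
  headOr∈ d {x ∷ xs} _ = here refl

  lastOr∈ : ∀ d {xs : List A} → NonEmpty xs → lastOr d xs ∈ xs
  lastOr∈ d {x ∷ []} _ = here refl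
  lastOr∈ d {x ∷ y ∷ ys} _ = there (lastOr∈ d {y ∷ ys} (s≤s z≤n))

  Unique-disjoint : ∀ {xs ys : List A} {x} → Unique (xs ++ ys) → x ∈ xs → x ∈ ys → ⊥
  Unique-disjoint {_ ∷ xs} (x∉ ∷ _) (here refl) x∈ys = All.lookup (Allₚ.++⁻ʳ xs x∉) x∈ys refl
  Unique-disjoint {_ ∷ xs} (_ ∷ u) (there x∈xs) x∈ys = Unique-disjoint u x∈xs x∈ys

  ∈-↭-split : ∀ {x} {xs : List A} → x ∈ xs → Σ[ ys ∈ List A ] (xs ↭ x ∷ ys)
  ∈-↭-split {xs = y ∷ xs} (here refl) = xs , ↭.refl
  ∈-↭-split {xs = y ∷ xs} (there x∈) with ∈-↭-split x∈
  ... | ys , p = y ∷ ys , ↭.trans (↭.prep y p) (↭.swap y _ ↭.refl)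

  DisjointPaths : List (List A) → Set
  DisjointPaths Ps = Unique (concat Ps) × All NonEmpty Ps

  DisjointPaths-↭ : ∀ {Ps Qs} → Ps ↭ Qs → DisjointPaths Ps → DisjointPaths Qs
  DisjointPaths-↭ p (u , ne) = Unique-resp-↭ (concat-↭ p) u , ↭ₚ.All-resp-↭ p ne

  DisjointPaths-++⁻ : ∀ Ps {Qs} → DisjointPaths (Ps ++ Qs) → DisjointPaths Ps × DisjointPaths Qs
  DisjointPaths-++⁻ Ps {Qs} (u , ne) with Unique-++⁻ (concat Ps) (subst Unique (sym (Listₚ.concat-++ Ps Qs)) u)
  ... | u₁ , u₂ = (u₁ , Allₚ.++⁻ˡ Ps ne) , (u₂ , Allₚ.++⁻ʳ Ps ne)

  same-path : ∀ {Ps : List (List A)} {X Y x} → Unique (concat Ps) → X ∈ Ps → Y ∈ Ps → x ∈ X → x ∈ Y → X ≡ Y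
  same-path {Z ∷ Ps} u (here refl) (here refl) _ _ = refl
  same-path {Z ∷ Ps} u (here refl) (there Y∈) x∈X x∈Y = ⊥-elim (Unique-disjoint {Z} u x∈X (∈-concat⁺′ x∈Y Y∈))
  same-path {Z ∷ Ps} u (there X∈) (here refl) x∈X x∈Y = ⊥-elim (Unique-disjoint {Z} u x∈Y (∈-concat⁺′ x∈X X∈))
  same-path {Z ∷ Ps} u (there X∈) (there Y∈) x∈X x∈Y = same-path (proj₂ (Unique-++⁻ Z u)) X∈ Y∈ x∈X x∈Y

  Unique-map-representative : ∀ (f : List A → A) → (∀ {X} → NonEmpty X → f X ∈ X) →
                              ∀ {Ps} → DisjointPaths Ps → Unique (map f Ps)
  Unique-map-representative f f∈ {[]} _ = []
  Unique-map-representative f f∈ {X ∷ Ps} (u , neX ∷ ne) =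
    All.tabulate distinct ∷ Unique-map-representative f f∈ (proj₂ (Unique-++⁻ X u) , ne)
    where
    distinct : ∀ {y} → y ∈ map f Ps → f X ≢ y
    distinct y∈ e with ∈-map⁻ f y∈
    ... | Y , Y∈ , refl =
      Unique-disjoint {X} u (f∈ neX) (subst (_∈ concat Ps) (sym e) (∈-concat⁺′ (f∈ (All.lookup ne Y∈)) Y∈))

module _ {A : Set} where

  HasPred HasSucc : List A → A → Set
  HasPred X x = Σ[ p ∈ A ] Consec X p x
  HasSucc X x = Σ[ q ∈ A ] Consec X x q

  Interior : List A → A → Set
  Interior X x = HasPred X x × HasSucc X x

  Consec-∈ : ∀ {X : List A} {x y} → Consec X x y → x ∈ X × y ∈ X
  Consec-∈ here = here refl , there (here refl)
  Consec-∈ (there c) = Data.Product.map there there (Consec-∈ c)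

  Consec-++ˡ : ∀ {X Y : List A} {x y} → Consec X x y → Consec (X ++ Y) x y
  Consec-++ˡ here = here
  Consec-++ˡ (there c) = there (Consec-++ˡ c)

  Consec-++ʳ : ∀ (X : List A) {Y x y} → Consec Y x y → Consec (X ++ Y) x y
  Consec-++ʳ [] c = c
  Consec-++ʳ (_ ∷ X) c = there (Consec-++ʳ X c)

  Consec-++-junction : ∀ d (X Y : List A) → NonEmpty X → NonEmpty Y → Consec (X ++ Y) (lastOr d X) (headOr d Y)
  Consec-++-junction d (x ∷ []) (y ∷ Y) _ _ = here
  Consec-++-junction d (x ∷ x′ ∷ X) Y _ neY = there (Consec-++-junction d (x′ ∷ X) Y (s≤s z≤n) neY)

  Consec-++⁻ : ∀ d (X Y : List A) {x y} → NonEmpty X → Consec (X ++ Y) x y →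
               Consec X x y ⊎ Consec Y x y ⊎ (x ≡ lastOr d X × y ≡ headOr d Y)
  Consec-++⁻ d (x ∷ []) (y ∷ Y) _ here = inj₂ (inj₂ (refl , refl))
  Consec-++⁻ d (x ∷ []) Y _ (there c) = inj₂ (inj₁ c)
  Consec-++⁻ d (x ∷ x′ ∷ X) Y _ here = inj₁ here
  Consec-++⁻ d (x ∷ x′ ∷ X) Y _ (there c) with Consec-++⁻ d (x′ ∷ X) Y (s≤s z≤n) c
  ... | inj₁ c′ = inj₁ (there c′)
  ... | inj₂ r = inj₂ r

  NonEmpty-++ : ∀ {X : List A} Y → NonEmpty X → NonEmpty (X ++ Y)
  NonEmpty-++ {_ ∷ _} Y _ = s≤s z≤n

  headOr-++ : ∀ d {X : List A} Y → NonEmpty X → headOr d (X ++ Y) ≡ headOr d X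
  headOr-++ d {_ ∷ _} Y _ = refl

  lastOr-snoc : ∀ d (X : List A) y → lastOr d (X ++ [ y ]) ≡ y
  lastOr-snoc d [] y = refl
  lastOr-snoc d (x ∷ []) y = refl
  lastOr-snoc d (x ∷ x′ ∷ X) y = lastOr-snoc d (x′ ∷ X) y

  NonEmpty-reverse : ∀ {X : List A} → NonEmpty X → NonEmpty (reverse X)
  NonEmpty-reverse {X} ne = subst (1 ≤_) (sym (Listₚ.length-reverse X)) ne

  lastOr-reverse : ∀ d (X : List A) → NonEmpty X → lastOr d (reverse X) ≡ headOr d X
  lastOr-reverse d (x ∷ X) _ = trans (cong (lastOr d) (Listₚ.unfold-reverse x X)) (lastOr-snoc d (reverse X) x)

  headOr-reverse : ∀ d (X : List A) → NonEmpty X → headOr d (reverse X) ≡ lastOr d X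
  headOr-reverse d X ne =
    sym (trans (cong (lastOr d) (sym (Listₚ.reverse-involutive X))) (lastOr-reverse d (reverse X) (NonEmpty-reverse {X} ne)))

  Consec-reverse⁻ : ∀ (X : List A) {x y} → Consec (reverse X) x y → Consec X y x
  Consec-reverse⁻ [] ()
  Consec-reverse⁻ (x ∷ []) (there ())
  Consec-reverse⁻ (x ∷ y ∷ X) {u} {w} c =
    Data.Sum.[ there ∘ Consec-reverse⁻ (y ∷ X) , Data.Sum.[ (λ { (there ()) }) , junction ]′ ]′
      (Consec-++⁻ x (reverse (y ∷ X)) [ x ] (NonEmpty-reverse {y ∷ X} (s≤s z≤n))
                  (subst (λ Z → Consec Z u w) (Listₚ.unfold-reverse x (y ∷ X)) c))
    where
    junction : u ≡ lastOr x (reverse (y ∷ X)) × w ≡ headOr x [ x ] → Consec (x ∷ y ∷ X) w u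
    junction (u≡ , refl) = subst (Consec (x ∷ y ∷ X) x) (sym (trans u≡ (lastOr-reverse x (y ∷ X) (s≤s z≤n)))) here

  Consec-reverse⁺ : ∀ (X : List A) {x y} → Consec X x y → Consec (reverse X) y x
  Consec-reverse⁺ X {x} {y} c = Consec-reverse⁻ (reverse X) (subst (λ Z → Consec Z x y) (sym (Listₚ.reverse-involutive X)) c)

  HasPred-there : ∀ {y x} {X : List A} → x ∈ X → HasPred (y ∷ X) x
  HasPred-there {y} {X = z ∷ X} (here refl) = y , here
  HasPred-there {X = z ∷ X} (there x∈) = Data.Product.map (λ p → p) there (HasPred-there {z} x∈)

  no-pred⇒head : ∀ d (X : List A) {x} → x ∈ X → ¬ HasPred X x → headOr d X ≡ x
  no-pred⇒head d (y ∷ X) (here refl) _ = refl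
  no-pred⇒head d (y ∷ X) (there x∈) ¬pred = contradiction (HasPred-there x∈) ¬pred

  no-succ⇒last : ∀ d (X : List A) {x} → x ∈ X → ¬ HasSucc X x → lastOr d X ≡ x
  no-succ⇒last d (y ∷ []) (here refl) _ = refl
  no-succ⇒last d (y ∷ z ∷ X) (here refl) ¬succ = contradiction (z , here) ¬succ
  no-succ⇒last d (y ∷ z ∷ X) (there x∈) ¬succ = no-succ⇒last d (z ∷ X) x∈ (λ (q , c) → ¬succ (q , there c))

  head-no-pred : ∀ d {X : List A} → Unique X → ¬ HasPred X (headOr d X)
  head-no-pred d {x ∷ X} (x∉ ∷ _) (_ , here) = All.lookup x∉ (here refl) refl
  head-no-pred d {x ∷ X} (x∉ ∷ _) (_ , there c) = All.lookup x∉ (proj₂ (Consec-∈ c)) refl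

  last-no-succ : ∀ d {X : List A} → Unique X → ¬ HasSucc X (lastOr d X)
  last-no-succ d {x ∷ []} _ (_ , there ())
  last-no-succ d {x ∷ y ∷ X} (x∉ ∷ _) (_ , here) = All.lookup x∉ (lastOr∈ d {y ∷ X} (s≤s z≤n)) refl
  last-no-succ d {x ∷ y ∷ X} (_ ∷ u) (q , there c) = last-no-succ d u (q , c)

module _ {A : Set} (d : A) where

  Consec-concat⁺ : ∀ {Ps : List (List A)} {X x y} → X ∈ Ps → Consec X x y → Consec (concat Ps) x y
  Consec-concat⁺ {Y ∷ Ps} (here refl) c = Consec-++ˡ c
  Consec-concat⁺ {Y ∷ Ps} (there X∈) c = Consec-++ʳ Y (Consec-concat⁺ X∈ c)

  Consec-concat-++⁻ : ∀ (Ps : List (List A)) E {x y} → All NonEmpty Ps → Consec (concat Ps ++ [ headOr d E ]) x y →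
                      (Σ[ X ∈ List A ] (X ∈ Ps × Consec X x y)) ⊎
                      (Σ[ X ∈ List A ] Σ[ Y ∈ List A ] (Consec (Ps ++ [ E ]) X Y × x ≡ lastOr d X × y ≡ headOr d Y))
  Consec-concat-++⁻ [] E _ (there ())
  Consec-concat-++⁻ (X ∷ Ps) E {x} {y} (neX ∷ ne) c
    with Consec-++⁻ d X (concat Ps ++ [ headOr d E ]) neX (subst (λ Z → Consec Z x y) (Listₚ.++-assoc X (concat Ps) _) c)
  ... | inj₁ cX = inj₁ (X , here refl , cX)
  ... | inj₂ (inj₁ c′) = Data.Sum.map (Data.Product.map₂ (Data.Product.map₁ there))
                                      (Data.Product.map₂ (Data.Product.map₂ (Data.Product.map₁ there)))
                                      (Consec-concat-++⁻ Ps E ne c′)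
  Consec-concat-++⁻ (X ∷ []) E (neX ∷ ne) c | inj₂ (inj₂ (x≡ , y≡)) = inj₂ (X , E , here , x≡ , y≡)
  Consec-concat-++⁻ (X ∷ Z ∷ Ps) E (neX ∷ neZ ∷ ne) c | inj₂ (inj₂ (x≡ , y≡)) =
    inj₂ (X , Z , here , x≡ ,
          trans y≡ (trans (cong (headOr d) (Listₚ.++-assoc Z (concat Ps) _)) (headOr-++ d {X = Z} (concat Ps ++ [ headOr d E ]) neZ)))

  closeCycle-concat : ∀ (X : List A) Ps → NonEmpty X → closeCycle (concat (X ∷ Ps)) ≡ concat (X ∷ Ps) ++ [ headOr d X ]
  closeCycle-concat (x ∷ X) Ps _ = refl

  Consec-closeCycle-concat⁻ : ∀ {Ps : List (List A)} {x y} → All NonEmpty Ps → Consec (closeCycle (concat Ps)) x y →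
                              (Σ[ X ∈ List A ] (X ∈ Ps × Consec X x y)) ⊎
                              (Σ[ X ∈ List A ] Σ[ Y ∈ List A ] (Consec (closeCycle Ps) X Y × x ≡ lastOr d X × y ≡ headOr d Y))
  Consec-closeCycle-concat⁻ {X ∷ Ps} {x} {y} ne@(neX ∷ _) c =
    Consec-concat-++⁻ (X ∷ Ps) X ne (subst (λ Z → Consec Z x y) (closeCycle-concat X Ps neX) c)

  Consec-closeCycle-concat⁺ : ∀ {Ps : List (List A)} {X x y} → All NonEmpty Ps → X ∈ Ps → Consec X x y →
                              Consec (closeCycle (concat Ps)) x y
  Consec-closeCycle-concat⁺ {Z ∷ Ps} (neZ ∷ _) X∈ c =
    subst (λ W → Consec W _ _) (sym (closeCycle-concat Z Ps neZ)) (Consec-++ˡ (Consec-concat⁺ X∈ c))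

  Unique-member : ∀ {Ps : List (List A)} {X} → Unique (concat Ps) → X ∈ Ps → Unique X
  Unique-member {Y ∷ Ps} u (here refl) = proj₁ (Unique-++⁻ Y u)
  Unique-member {Y ∷ Ps} u (there X∈) = Unique-member (proj₂ (Unique-++⁻ Y u)) X∈

  Unique-paths : ∀ {Ps : List (List A)} → DisjointPaths Ps → Unique Ps
  Unique-paths {[]} _ = []
  Unique-paths {X ∷ Ps} (u , neX ∷ ne) = All.tabulate distinct ∷ Unique-paths (proj₂ (Unique-++⁻ X u) , ne)
    where
    distinct : ∀ {Y} → Y ∈ Ps → X ≢ Y
    distinct Y∈ refl = Unique-disjoint {xs = X} u (headOr∈ d neX) (∈-concat⁺′ (headOr∈ d neX) Y∈)

module _ {A : Set} where

  Adjacent : List A → A → A → Set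
  Adjacent X x y = Consec X x y ⊎ Consec X y x

  Adjacent-sym : ∀ {X : List A} {x y} → Adjacent X x y → Adjacent X y x
  Adjacent-sym (inj₁ c) = inj₂ c
  Adjacent-sym (inj₂ c) = inj₁ c

  Covered : (A → Set) → List A → Set
  Covered H X = ∀ {x y} → Consec X x y → H x ⊎ H y

  record Reorientation (X X′ : List A) : Set where
    field
      reorder    : X′ ↭ X
      adjacent⁺  : ∀ {x y} → Adjacent X x y → Adjacent X′ x y
      adjacent⁻  : ∀ {x y} → Adjacent X′ x y → Adjacent X x y
      interior⁺  : ∀ {x} → Interior X x → Interior X′ x
      nonEmpty   : NonEmpty X′

  reorient-id : ∀ {X : List A} → NonEmpty X → Reorientation X X
  reorient-id ne = record
    { reorder = ↭.refl ; adjacent⁺ = λ a → a ; adjacent⁻ = λ a → a ; interior⁺ = λ i → i ; nonEmpty = ne }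

  reorient-reverse : ∀ {X : List A} → NonEmpty X → Reorientation X (reverse X)
  reorient-reverse {X} ne = record
    { reorder = ↭ₚ.↭-reverse X
    ; adjacent⁺ = Data.Sum.swap ∘ Data.Sum.map (Consec-reverse⁺ X) (Consec-reverse⁺ X)
    ; adjacent⁻ = Data.Sum.swap ∘ Data.Sum.map (Consec-reverse⁻ X) (Consec-reverse⁻ X)
    ; interior⁺ = λ { ((p , cp) , (q , cq)) → (q , Consec-reverse⁺ X cq) , (p , Consec-reverse⁺ X cp) }
    ; nonEmpty = NonEmpty-reverse {X = X} ne }

  module _ (_≟_ : DecidableEquality A) where

    hasPred? : ∀ X x → Dec (HasPred X x)
    hasPred? [] x = no λ ()
    hasPred? (y ∷ []) x = no λ { (_ , there ()) }
    hasPred? (y ∷ z ∷ zs) x with z ≟ x | hasPred? (z ∷ zs) x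
    ... | yes refl | _ = yes (y , here)
    ... | no _ | yes (p , c) = yes (p , there c)
    ... | no z≢x | no ¬pred = no λ { (_ , here) → z≢x refl ; (p , there c) → ¬pred (p , c) }

    hasSucc? : ∀ X x → Dec (HasSucc X x)
    hasSucc? [] x = no λ ()
    hasSucc? (y ∷ []) x = no λ { (_ , there ()) }
    hasSucc? (y ∷ z ∷ zs) x with y ≟ x | hasSucc? (z ∷ zs) x
    ... | yes refl | _ = yes (z , here)
    ... | no _ | yes (q , c) = yes (q , there c)
    ... | no y≢x | no ¬succ = no λ { (_ , here) → y≢x refl ; (q , there c) → ¬succ (q , c) }

    orient-ending-at : ∀ d X {x} → NonEmpty X → x ∈ X → ¬ Interior X x →
                       Σ[ X′ ∈ List A ] (Reorientation X X′ × lastOr d X′ ≡ x)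
    orient-ending-at d X {x} ne x∈ ¬int with hasSucc? X x
    ... | no ¬succ = X , reorient-id ne , no-succ⇒last d X x∈ ¬succ
    ... | yes succ = reverse X , reorient-reverse ne ,
                     trans (lastOr-reverse d X ne) (no-pred⇒head d X x∈ (λ pred → ¬int (pred , succ)))

    orient-starting-at : ∀ d X {x} → NonEmpty X → x ∈ X → ¬ Interior X x →
                         Σ[ X′ ∈ List A ] (Reorientation X X′ × headOr d X′ ≡ x)
    orient-starting-at d X {x} ne x∈ ¬int with hasPred? X x
    ... | no ¬pred = X , reorient-id ne , no-pred⇒head d X x∈ ¬pred
    ... | yes pred = reverse X , reorient-reverse ne ,
                     trans (headOr-reverse d X ne) (no-succ⇒last d X x∈ (λ succ → ¬int (pred , succ)))

  Covered-reorient : ∀ {H : A → Set} {X X′} → Reorientation X X′ → Covered H X → Covered H X′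
  Covered-reorient ρ cov c with Reorientation.adjacent⁻ ρ (inj₁ c)
  ... | inj₁ c′ = cov c′
  ... | inj₂ c′ = Data.Sum.swap (cov c′)

-- Linking paths into a cycle that avoids forbidden links

module Linking {V : Set} (d : V) {Forbidden : V → V → Set} (Forbidden? : ∀ a b → Dec (Forbidden a b))
               (Forbidden-sym : ∀ {a b} → Forbidden a b → Forbidden b a) (t : ℕ)
               (few : ∀ v {xs} → Unique xs → count (Forbidden? v) xs ≤ t) where

  Linkable : List V → List V → Set
  Linkable X Y = ¬ Forbidden (lastOr d X) (headOr d Y)

  Chain : List V → List (List V) → List V → Set
  Chain X [] Z = Linkable X Z
  Chain X (Y ∷ Ys) Z = Linkable X Y × Chain Y Ys Z

  CannotFollow CannotPrecede : List V → List V → Set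
  CannotFollow x X = Forbidden (lastOr d X) (headOr d x)
  CannotPrecede x Y = Forbidden (lastOr d x) (headOr d Y)

  cannotFollow? : ∀ x X → Dec (CannotFollow x X)
  cannotFollow? x X = Forbidden? (lastOr d X) (headOr d x)

  cannotPrecede? : ∀ x Y → Dec (CannotPrecede x Y)
  cannotPrecede? x Y = Forbidden? (lastOr d x) (headOr d Y)

  misfits : List V → List V → List (List V) → List V → ℕ
  misfits x X [] Z = indicator (cannotFollow? x X ⊎-dec cannotPrecede? x Z)
  misfits x X (Y ∷ Ys) Z = indicator (cannotFollow? x X ⊎-dec cannotPrecede? x Y) + misfits x Y Ys Z

  insert : ∀ x X Ys Z → Chain X Ys Z → misfits x X Ys Z < suc (length Ys) →
           Σ[ Zs ∈ List (List V) ] (Chain X Zs Z × Zs ↭ x ∷ Ys)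
  insert x X [] Z ch lt with cannotFollow? x X ⊎-dec cannotPrecede? x Z
  ... | yes _ = contradiction lt (<-irrefl refl)
  ... | no fits = [ x ] , (fits ∘ inj₁ , fits ∘ inj₂) , ↭.refl
  insert x X (Y ∷ Ys) Z (ok , ch) lt with cannotFollow? x X ⊎-dec cannotPrecede? x Y
  ... | no fits = x ∷ Y ∷ Ys , (fits ∘ inj₁ , fits ∘ inj₂ , ch) , ↭.refl
  ... | yes _ with insert x Y Ys Z ch (s≤s⁻¹ lt)
  ...   | Zs , ch′ , p = Y ∷ Zs , (ok , ch′) , ↭.trans (↭.prep Y p) (↭.swap Y x ↭.refl)

  misfits≤ : ∀ x X Ys Z → misfits x X Ys Z ≤ count (cannotFollow? x) (X ∷ Ys) + count (cannotPrecede? x) (Ys ++ [ Z ])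
  misfits≤ x X [] Z =
    subst₂ (λ a b → misfits x X [] Z ≤ a + b)
      (sym (+-identityʳ (indicator (cannotFollow? x X)))) (sym (+-identityʳ (indicator (cannotPrecede? x Z))))
      (indicator-⊎ (λ m → m) (cannotFollow? x X ⊎-dec cannotPrecede? x Z) (cannotFollow? x X) (cannotPrecede? x Z))
  misfits≤ x X (Y ∷ Ys) Z =
    ≤-trans (+-mono-≤ (indicator-⊎ (λ m → m) (cannotFollow? x X ⊎-dec cannotPrecede? x Y)
                                    (cannotFollow? x X) (cannotPrecede? x Y))
                      (misfits≤ x Y Ys Z))
            (≤-reflexive (interchange (indicator (cannotFollow? x X)) (indicator (cannotPrecede? x Y))
                                      (count (cannotFollow? x) (Y ∷ Ys)) (count (cannotPrecede? x) (Ys ++ [ Z ]))))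

  Chain⇒Linkable : ∀ {X Ys Z P Q} → Chain X Ys Z → Consec (X ∷ Ys ++ [ Z ]) P Q → Linkable P Q
  Chain⇒Linkable {Ys = []} ok here = ok
  Chain⇒Linkable {Ys = []} ok (there (there ()))
  Chain⇒Linkable {Ys = Y ∷ Ys} (ok , _) here = ok
  Chain⇒Linkable {Ys = Y ∷ Ys} (_ , ch) (there c) = Chain⇒Linkable ch c

  followers≤ : ∀ x {Ps} → Unique (map (lastOr d) Ps) → count (cannotFollow? x) Ps ≤ t
  followers≤ x {Ps} u =
    ≤-trans (count-mono (cannotFollow? x) (λ X → Forbidden? (headOr d x) (lastOr d X)) Forbidden-sym Ps)
      (≤-trans (≤-reflexive (sym (count-map (Forbidden? (headOr d x)) (lastOr d) Ps))) (few (headOr d x) u))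

  precedents≤ : ∀ x {Ps} → Unique (map (headOr d) Ps) → count (cannotPrecede? x) Ps ≤ t
  precedents≤ x {Ps} u = ≤-trans (≤-reflexive (sym (count-map (Forbidden? (lastOr d x)) (headOr d) Ps))) (few (lastOr d x) u)

  Unique-heads : ∀ {Ps} → DisjointPaths Ps → Unique (map (headOr d) Ps)
  Unique-heads = Unique-map-representative (headOr d) (headOr∈ d)

  Unique-lasts : ∀ {Ps} → DisjointPaths Ps → Unique (map (lastOr d) Ps)
  Unique-lasts = Unique-map-representative (lastOr d) (lastOr∈ d)

  successor : List (List V) → List V → List V
  successor [] Z = Z
  successor (Y ∷ _) Z = Y

  Chain-∷ : ∀ {X Ys Z x} → Chain X Ys Z → Linkable X x → Linkable x (successor Ys Z) → Chain X (x ∷ Ys) Z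
  Chain-∷ {Ys = []} ch ok₁ ok₂ = ok₁ , ok₂
  Chain-∷ {Ys = Y ∷ Ys} (_ , ch) ok₁ ok₂ = ok₁ , ok₂ , ch

  -- The ends of x have at most t forbidden partners each and the path ends are distinct,
  -- so at most 2t of the 1 + length Ys gaps of the chain reject x.
  insertion : ∀ x X Ys → Chain X Ys X → DisjointPaths (X ∷ Ys) → t + t < suc (length Ys) →
              Σ[ Zs ∈ List (List V) ] (Chain X Zs X × Zs ↭ x ∷ Ys)
  insertion x X Ys ch ps long = insert x X Ys X ch (≤-<-trans misfits≤2t long)
    where
    misfits≤2t : misfits x X Ys X ≤ t + t
    misfits≤2t = ≤-trans (misfits≤ x X Ys X)
      (+-mono-≤ (followers≤ x {X ∷ Ys} (Unique-lasts ps))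
                (precedents≤ x {Ys ++ [ X ]} (Unique-heads (DisjointPaths-↭ (↭ₚ.∷↭∷ʳ X Ys) ps))))

  prepending : ∀ X Ys R → Chain X Ys X → DisjointPaths R → t + t < length R →
               Σ[ x ∈ List V ] Σ[ R′ ∈ List (List V) ] (R ↭ x ∷ R′ × Chain X (x ∷ Ys) X)
  prepending X Ys R ch ps many
    with ∃-avoiding (cannotPrecede? X) (cannotFollow? (successor Ys X)) R
           (≤-<-trans (+-mono-≤ (precedents≤ X (Unique-heads ps)) (followers≤ (successor Ys X) (Unique-lasts ps))) many)
  ... | x , x∈R , ok₁ , ok₂ with ∈-↭-split x∈R
  ...   | R′ , p = x , R′ , p , Chain-∷ {X = X} ch ok₁ ok₂

  link : ∀ k X Ys R → length R ≡ k → Chain X Ys X → DisjointPaths (X ∷ Ys ++ R) →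
         (t + t) + (t + t) ≤ length Ys + k → Σ[ Zs ∈ List (List V) ] (Chain X Zs X × Zs ↭ Ys ++ R)
  link zero X Ys [] _ ch _ _ = Ys , ch , ↭-sym (↭ₚ.++-identityʳ Ys)
  link (suc k) X Ys R len ch ps size with t + t <? suc k
  ... | yes many = prepend (prepending X Ys R ch (DisjointPaths-++⁻ (X ∷ Ys) ps .proj₂) (subst (t + t <_) (sym len) many))
    where
    prepend : Σ[ x ∈ List V ] Σ[ R′ ∈ List (List V) ] (R ↭ x ∷ R′ × Chain X (x ∷ Ys) X) →
              Σ[ Zs ∈ List (List V) ] (Chain X Zs X × Zs ↭ Ys ++ R)
    prepend (x , R′ , p , ch′) =
      let Zs , ch″ , q = link k X (x ∷ Ys) R′ len′ ch′ (DisjointPaths-↭ reorder ps) size′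
      in Zs , ch″ , ↭.trans q (↭.trans (↭-sym (↭ₚ.shift x Ys R′)) (↭ₚ.++⁺ˡ Ys (↭-sym p)))
      where
      len′ : length R′ ≡ k
      len′ = suc-injective (trans (sym (↭ₚ.↭-length p)) len)
      reorder : X ∷ Ys ++ R ↭ X ∷ (x ∷ Ys) ++ R′
      reorder = ↭.prep X (↭.trans (↭ₚ.++⁺ˡ Ys p) (↭ₚ.shift x Ys R′))
      size′ : (t + t) + (t + t) ≤ suc (length Ys) + k
      size′ = subst ((t + t) + (t + t) ≤_) (+-suc (length Ys) k) size
  link (suc k) X Ys (x ∷ R′) len ch ps size | no few′ =
    place (insertion x X Ys ch (DisjointPaths-++⁻ (X ∷ Ys) ps .proj₁) long)
    where
    long : t + t < suc (length Ys)
    long = s≤s (+-cancelʳ-≤ (t + t) (t + t) (length Ys) (≤-trans size (+-monoʳ-≤ (length Ys) (≮⇒≥ few′))))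
    place : Σ[ Zs ∈ List (List V) ] (Chain X Zs X × Zs ↭ x ∷ Ys) →
            Σ[ Zs ∈ List (List V) ] (Chain X Zs X × Zs ↭ Ys ++ x ∷ R′)
    place (Zs₁ , ch₁ , p) =
      let Zs , ch″ , q = link k X Zs₁ R′ (suc-injective len) ch₁ (DisjointPaths-↭ reorder ps) size′
      in Zs , ch″ , ↭.trans q (↭.trans (↭ₚ.++⁺ʳ R′ p) (↭-sym (↭ₚ.shift x Ys R′)))
      where
      reorder : X ∷ Ys ++ x ∷ R′ ↭ X ∷ Zs₁ ++ R′
      reorder = ↭.prep X (↭.trans (↭ₚ.shift x Ys R′) (↭ₚ.++⁺ʳ R′ (↭-sym p)))
      size′ : (t + t) + (t + t) ≤ length Zs₁ + k
      size′ = subst (λ l → (t + t) + (t + t) ≤ l + k) (sym (↭ₚ.↭-length p))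
                (subst ((t + t) + (t + t) ≤_) (+-suc (length Ys) k) size)

  link-cycle : ∀ X Rest → DisjointPaths (X ∷ Rest) → Linkable X X → (t + t) + (t + t) ≤ length Rest →
               Σ[ Zs ∈ List (List V) ] (Chain X Zs X × Zs ↭ Rest)
  link-cycle X Rest ps ok size = link (length Rest) X [] Rest refl ok ps size

-- The adversary

module Adversary (n : ℕ) (d : Fin n) (t : ℕ) where

  V : Set
  V = Fin n

  Forbidden : List (V × V) → V → V → Set
  Forbidden F a b = (a , b) ∈ F ⊎ (b , a) ∈ F

  forbidden? : ∀ F a b → Dec (Forbidden F a b)
  forbidden? F a b = Any.any? ((a , b) ≟ₚ_) F ⊎-dec Any.any? ((b , a) ≟ₚ_) F
    where _≟ₚ_ = ≡-dec Fin._≟_ Fin._≟_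

  Forbidden-sym : ∀ {F a b} → Forbidden F a b → Forbidden F b a
  Forbidden-sym = Data.Sum.swap

  Incident : V → V × V → Set
  Incident v (a , b) = v ≡ a ⊎ v ≡ b

  incident? : ∀ v e → Dec (Incident v e)
  incident? v (a , b) = (v Fin.≟ a) ⊎-dec (v Fin.≟ b)

  degree : List (V × V) → V → ℕ
  degree F v = count (incident? v) F

  Heavy : List (V × V) → V → Set
  Heavy F v = t ≤ degree F v

  PathEdge : List (List V) → V → V → Set
  PathEdge Ps a b = Any (λ X → Adjacent X a b) Ps

  pathEdge? : ∀ Ps a b → Dec (PathEdge Ps a b)
  pathEdge? Ps a b = Any.any? (λ X → consec? Fin._≟_ X a b ⊎-dec consec? Fin._≟_ X b a) Ps

  PathEdge-sym : ∀ {Ps a b} → PathEdge Ps a b → PathEdge Ps b a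
  PathEdge-sym = Any.map Adjacent-sym

  -- Pairs that can no longer become path edges, so they are answered 0 without being forbidden.
  Blocked : List (List V) → V → V → Set
  Blocked Ps a b = Any (λ X → Interior X a) Ps ⊎ Any (λ X → Interior X b) Ps ⊎ Any (λ X → a ∈ X × b ∈ X) Ps

  blocked? : ∀ Ps a b → Dec (Blocked Ps a b)
  blocked? Ps a b = Any.any? (interior? a) Ps ⊎-dec Any.any? (interior? b) Ps ⊎-dec Any.any? both∈? Ps
    where
    interior? : ∀ x X → Dec (Interior X x)
    interior? x X = hasPred? Fin._≟_ X x ×-dec hasSucc? Fin._≟_ X x
    both∈? : ∀ X → Dec (a ∈ X × b ∈ X)
    both∈? X = Any.any? (a Fin.≟_) X ×-dec Any.any? (b Fin.≟_) X

  Blocked-sym : ∀ {Ps a b} → Blocked Ps a b → Blocked Ps b a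
  Blocked-sym (inj₁ i) = inj₂ (inj₁ i)
  Blocked-sym (inj₂ (inj₁ i)) = inj₁ i
  Blocked-sym (inj₂ (inj₂ s)) = inj₂ (inj₂ (Any.map Data.Product.swap s))

  -- Query answers are not stored: a state determines them (1 on path edges, 0 on blocked and
  -- forbidden pairs), which is what Consistent expresses.
  record State : Set where
    constructor ⟨_,_⟩
    field
      paths     : List (List V)
      forbidden : List (V × V)
  open State public

  record Invariant (s : State) : Set where
    field
      partition       : concat (paths s) ↭ allFin n
      nonEmpty        : All NonEmpty (paths s)
      covered         : All (Covered (Heavy (forbidden s))) (paths s)
      degree≤         : ∀ v → degree (forbidden s) v ≤ t
      forbidden-apart : ∀ {a b} → Forbidden (forbidden s) a b → ¬ PathEdge (paths s) a b
      forbidden-irrefl : ∀ {a b} → (a , b) ∈ forbidden s → a ≢ b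

  record Consistent (G : Graph n) (s : State) : Set where
    field
      path-edge      : ∀ {a b} → PathEdge (paths s) a b → adj G a b ≡ true
      blocked-edge   : ∀ {a b} → Blocked (paths s) a b → ¬ PathEdge (paths s) a b → adj G a b ≢ true
      forbidden-edge : ∀ {a b} → Forbidden (forbidden s) a b → adj G a b ≢ true

  record Answer (s : State) (e : Edge n) : Set where
    field
      bit       : Bool
      next      : State
      invariant : Invariant next
      growth    : length (forbidden next) ≤ suc (length (forbidden s))
      refines   : ∀ G → Consistent G next → Consistent G s × G e ≡ bit

  adj-< : ∀ (G : Graph n) {a b} (a<b : a Fin.< b) → adj G a b ≡ G (a , b , a<b)
  adj-< G {a} {b} a<b with a Fin.<? b
  ... | yes a<b′ = cong (λ p → G (a , b , p)) (≤-irrelevant a<b′ a<b)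
  ... | no a≮b = contradiction a<b a≮b

  ≢true⇒false : ∀ {x : Bool} → x ≢ true → x ≡ false
  ≢true⇒false {false} _ = refl
  ≢true⇒false {true} x≢true = contradiction refl x≢true

  stay : ∀ {s} → Invariant s → ∀ e β → (∀ G → Consistent G s → G e ≡ β) → Answer s e
  stay {s} I e β forced = record
    { bit = β ; next = s ; invariant = I ; growth = n≤1+n _ ; refines = λ G c → c , forced G c }

  Heavy-∷ : ∀ {F} p {v} → Heavy F v → Heavy (p ∷ F) v
  Heavy-∷ {F} p {v} h = ≤-trans h (m≤n+m (degree F v) (indicator (incident? v p)))

  module Forbid (s : State) (I : Invariant s) {a b} (a≢b : a ≢ b) (¬edge : ¬ PathEdge (paths s) a b)
                (light-a : ¬ Heavy (forbidden s) a) (light-b : ¬ Heavy (forbidden s) b) where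
    open Invariant I

    next : State
    next = ⟨ paths s , (a , b) ∷ forbidden s ⟩

    invariant : Invariant next
    invariant = record
      { partition = partition
      ; nonEmpty = nonEmpty
      ; covered = All.map (λ cov {x} {y} c → Data.Sum.map (Heavy-∷ {forbidden s} (a , b)) (Heavy-∷ {forbidden s} (a , b)) (cov c))
                          covered
      ; degree≤ = degree≤′
      ; forbidden-apart = apart
      ; forbidden-irrefl = λ { (here refl) → a≢b ; (there ab∈) → forbidden-irrefl ab∈ } }
      where
      degree≤′ : ∀ v → degree ((a , b) ∷ forbidden s) v ≤ t
      degree≤′ v with incident? v (a , b)
      ... | yes (inj₁ refl) = ≰⇒> light-a
      ... | yes (inj₂ refl) = ≰⇒> light-b
      ... | no _ = degree≤ v
      apart : ∀ {x y} → Forbidden ((a , b) ∷ forbidden s) x y → ¬ PathEdge (paths s) x y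
      apart (inj₁ (here refl)) = ¬edge
      apart (inj₁ (there xy∈)) = forbidden-apart (inj₁ xy∈)
      apart (inj₂ (here refl)) = ¬edge ∘ PathEdge-sym
      apart (inj₂ (there yx∈)) = forbidden-apart (inj₂ yx∈)

    refines : ∀ G → Consistent G next → Consistent G s
    refines G c = record
      { path-edge = path-edge ; blocked-edge = blocked-edge
      ; forbidden-edge = forbidden-edge ∘ Data.Sum.map there there }
      where open Consistent c

    forbidden-ab : Forbidden (forbidden next) a b
    forbidden-ab = inj₁ (here refl)

  module Join (s : State) (I : Invariant s) {a b} (¬blocked : ¬ Blocked (paths s) a b)
              (¬forbidden : ¬ Forbidden (forbidden s) a b) (heavy : Heavy (forbidden s) a ⊎ Heavy (forbidden s) b)
              (X Y : List V) (Qs : List (List V)) (split : paths s ↭ X ∷ Y ∷ Qs) (a∈X : a ∈ X) (b∈Y : b ∈ Y) where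
    open Invariant I

    private
      Ps = paths s
      F = forbidden s

      toSplit : ∀ {P : List V → Set} → Any P Ps → Any P (X ∷ Y ∷ Qs)
      toSplit = ↭ₚ.Any-resp-↭ split

      fromSplit : ∀ {P : List V → Set} → Any P (X ∷ Y ∷ Qs) → Any P Ps
      fromSplit = ↭ₚ.Any-resp-↭ (↭-sym split)

      X∈ : X ∈ Ps
      X∈ = fromSplit (here refl)

      Y∈ : Y ∈ Ps
      Y∈ = fromSplit (there (here refl))

      orientX = orient-ending-at Fin._≟_ d X (All.lookup nonEmpty X∈) a∈X (λ i → ¬blocked (inj₁ (lose X∈ i)))
      orientY = orient-starting-at Fin._≟_ d Y (All.lookup nonEmpty Y∈) b∈Y (λ i → ¬blocked (inj₂ (inj₁ (lose Y∈ i))))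

      X′ = proj₁ orientX
      ρX = proj₁ (proj₂ orientX)
      Y′ = proj₁ orientY
      ρY = proj₁ (proj₂ orientY)
      module ρX = Reorientation ρX
      module ρY = Reorientation ρY

      last-X′ : lastOr d X′ ≡ a
      last-X′ = proj₂ (proj₂ orientX)

      head-Y′ : headOr d Y′ ≡ b
      head-Y′ = proj₂ (proj₂ orientY)

    joined : List V
    joined = X′ ++ Y′

    next : State
    next = ⟨ joined ∷ Qs , F ⟩

    Consec-joined⁻ : ∀ {x y} → Consec joined x y → Adjacent X x y ⊎ Adjacent Y x y ⊎ (x ≡ a × y ≡ b)
    Consec-joined⁻ c with Consec-++⁻ d X′ Y′ ρX.nonEmpty c
    ... | inj₁ cX = inj₁ (ρX.adjacent⁻ (inj₁ cX))
    ... | inj₂ (inj₁ cY) = inj₂ (inj₁ (ρY.adjacent⁻ (inj₁ cY)))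
    ... | inj₂ (inj₂ (refl , refl)) = inj₂ (inj₂ (last-X′ , head-Y′))

    PathEdge-next⁻ : ∀ {x y} → PathEdge (paths next) x y → PathEdge Ps x y ⊎ (x ≡ a × y ≡ b) ⊎ (x ≡ b × y ≡ a)
    PathEdge-next⁻ (here (inj₁ c)) with Consec-joined⁻ c
    ... | inj₁ adjX = inj₁ (fromSplit (here adjX))
    ... | inj₂ (inj₁ adjY) = inj₁ (fromSplit (there (here adjY)))
    ... | inj₂ (inj₂ ab) = inj₂ (inj₁ ab)
    PathEdge-next⁻ (here (inj₂ c)) with Consec-joined⁻ c
    ... | inj₁ adjX = inj₁ (fromSplit (here (Adjacent-sym adjX)))
    ... | inj₂ (inj₁ adjY) = inj₁ (fromSplit (there (here (Adjacent-sym adjY))))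
    ... | inj₂ (inj₂ (refl , refl)) = inj₂ (inj₂ (refl , refl))
    PathEdge-next⁻ (there e) = inj₁ (fromSplit (there (there e)))

    Adjacent-joinedˡ : ∀ {x y} → Adjacent X x y → Adjacent joined x y
    Adjacent-joinedˡ = Data.Sum.map Consec-++ˡ Consec-++ˡ ∘ ρX.adjacent⁺

    Adjacent-joinedʳ : ∀ {x y} → Adjacent Y x y → Adjacent joined x y
    Adjacent-joinedʳ = Data.Sum.map (Consec-++ʳ X′) (Consec-++ʳ X′) ∘ ρY.adjacent⁺

    PathEdge-next⁺ : ∀ {x y} → PathEdge Ps x y → PathEdge (paths next) x y
    PathEdge-next⁺ e with toSplit e
    ... | here adjX = here (Adjacent-joinedˡ adjX)
    ... | there (here adjY) = here (Adjacent-joinedʳ adjY)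
    ... | there (there e′) = there e′

    Interior-next⁺ : ∀ {x} → Any (λ Z → Interior Z x) Ps → Any (λ Z → Interior Z x) (paths next)
    Interior-next⁺ i with toSplit i
    ... | here iX = let (p , cp) , (q , cq) = ρX.interior⁺ iX in here ((p , Consec-++ˡ cp) , (q , Consec-++ˡ cq))
    ... | there (here iY) = let (p , cp) , (q , cq) = ρY.interior⁺ iY in here ((p , Consec-++ʳ X′ cp) , (q , Consec-++ʳ X′ cq))
    ... | there (there i′) = there i′

    SamePath-next⁺ : ∀ {x y} → Any (λ Z → x ∈ Z × y ∈ Z) Ps → Any (λ Z → x ∈ Z × y ∈ Z) (paths next)
    SamePath-next⁺ sp with toSplit sp
    ... | here (x∈ , y∈) = here (inX x∈ , inX y∈)
      where inX = λ {z} (z∈ : z ∈ X) → ∈-++⁺ˡ (↭ₚ.∈-resp-↭ (↭-sym ρX.reorder) z∈)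
    ... | there (here (x∈ , y∈)) = here (inY x∈ , inY y∈)
      where inY = λ {z} (z∈ : z ∈ Y) → ∈-++⁺ʳ X′ (↭ₚ.∈-resp-↭ (↭-sym ρY.reorder) z∈)
    ... | there (there sp′) = there sp′

    Blocked-next⁺ : ∀ {x y} → Blocked Ps x y → Blocked (paths next) x y
    Blocked-next⁺ = Data.Sum.map Interior-next⁺ (Data.Sum.map Interior-next⁺ SamePath-next⁺)

    edge-ab : PathEdge (paths next) a b
    edge-ab = here (inj₁ (subst₂ (Consec joined) last-X′ head-Y′ (Consec-++-junction d X′ Y′ ρX.nonEmpty ρY.nonEmpty)))

    invariant : Invariant next
    invariant = record
      { partition = ↭.trans (↭.↭-reflexive (Listₚ.++-assoc X′ Y′ (concat Qs)))
                     (↭.trans (↭ₚ.++⁺ ρX.reorder (↭ₚ.++⁺ʳ (concat Qs) ρY.reorder))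
                       (↭.trans (concat-↭ (↭-sym split)) partition))
      ; nonEmpty = NonEmpty-++ {X = X′} Y′ ρX.nonEmpty ∷ drop₂ (↭ₚ.All-resp-↭ split nonEmpty)
      ; covered = covered-joined ∷ drop₂ (↭ₚ.All-resp-↭ split covered)
      ; degree≤ = degree≤
      ; forbidden-apart = apart
      ; forbidden-irrefl = forbidden-irrefl }
      where
      drop₂ : ∀ {P : List V → Set} → All P (X ∷ Y ∷ Qs) → All P Qs
      drop₂ (_ ∷ _ ∷ ps) = ps
      covered-joined : Covered (Heavy F) joined
      covered-joined c with Consec-++⁻ d X′ Y′ ρX.nonEmpty c
      ... | inj₁ cX = Covered-reorient ρX (All.lookup covered X∈) cX
      ... | inj₂ (inj₁ cY) = Covered-reorient ρY (All.lookup covered Y∈) cY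
      ... | inj₂ (inj₂ (refl , refl)) = subst₂ (λ x y → Heavy F x ⊎ Heavy F y) (sym last-X′) (sym head-Y′) heavy
      apart : ∀ {x y} → Forbidden F x y → ¬ PathEdge (paths next) x y
      apart f e with PathEdge-next⁻ e
      ... | inj₁ e′ = forbidden-apart f e′
      ... | inj₂ (inj₁ (refl , refl)) = ¬forbidden f
      ... | inj₂ (inj₂ (refl , refl)) = ¬forbidden (Forbidden-sym f)

    refines : ∀ G → Consistent G next → Consistent G s
    refines G c = record
      { path-edge = path-edge ∘ PathEdge-next⁺
      ; blocked-edge = λ bl ¬e → blocked-edge (Blocked-next⁺ bl) (new-edge bl ¬e ∘ PathEdge-next⁻)
      ; forbidden-edge = forbidden-edge }
      where
      open Consistent c
      new-edge : ∀ {x y} → Blocked Ps x y → ¬ PathEdge Ps x y →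
                 ¬ (PathEdge Ps x y ⊎ (x ≡ a × y ≡ b) ⊎ (x ≡ b × y ≡ a))
      new-edge bl ¬e (inj₁ e) = ¬e e
      new-edge bl ¬e (inj₂ (inj₁ (refl , refl))) = ¬blocked bl
      new-edge bl ¬e (inj₂ (inj₂ (refl , refl))) = ¬blocked (Blocked-sym bl)

  unique-vertices : ∀ {s} → Invariant s → Unique (concat (paths s))
  unique-vertices I = Unique-resp-↭ (↭-sym (Invariant.partition I)) (allFin⁺ n)

  ∈-paths : ∀ {s} → Invariant s → ∀ x → x ∈ concat (paths s)
  ∈-paths I x = ↭ₚ.∈-resp-↭ (↭-sym (Invariant.partition I)) (∈-allFin x)

  separate-paths : ∀ {s} → Invariant s → ∀ {a b} → ¬ Blocked (paths s) a b →
                   Σ[ X ∈ List V ] Σ[ Y ∈ List V ] Σ[ Qs ∈ List (List V) ] (paths s ↭ X ∷ Y ∷ Qs × a ∈ X × b ∈ Y)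
  separate-paths {s} I {a} {b} ¬blocked with ∈-concat⁻′ (paths s) (∈-paths I a)
  ... | X , a∈X , X∈ with ∈-↭-split X∈
  ...   | Rest , split with ∈-++⁻ X (↭ₚ.∈-resp-↭ (concat-↭ split) (∈-paths I b))
  ...     | inj₁ b∈X = contradiction (inj₂ (inj₂ (lose X∈ (a∈X , b∈X)))) ¬blocked
  ...     | inj₂ b∈Rest with ∈-concat⁻′ Rest b∈Rest
  ...       | Y , b∈Y , Y∈ with ∈-↭-split Y∈
  ...         | Qs , split′ = X , Y , Qs , ↭.trans split (↭.prep X split′) , a∈X , b∈Y

  join : ∀ s → Invariant s → ∀ {a b} (a<b : a Fin.< b) → ¬ Blocked (paths s) a b → ¬ Forbidden (forbidden s) a b →
         Heavy (forbidden s) a ⊎ Heavy (forbidden s) b → Answer s (a , b , a<b)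
  join s I a<b ¬blocked ¬forbidden heavy with separate-paths I ¬blocked
  ... | X , Y , Qs , split , a∈X , b∈Y = record
    { bit = true ; next = next ; invariant = invariant ; growth = n≤1+n _
    ; refines = λ G c → refines G c , trans (sym (adj-< G a<b)) (Consistent.path-edge c edge-ab) }
    where open Join s I ¬blocked ¬forbidden heavy X Y Qs split a∈X b∈Y

  answer : ∀ s → Invariant s → (e : Edge n) → Answer s e
  answer s I (a , b , a<b) with pathEdge? (paths s) a b
  ... | yes edge = stay I _ true λ G c → trans (sym (adj-< G a<b)) (Consistent.path-edge c edge)
  ... | no ¬edge with blocked? (paths s) a b
  ... | yes blocked = stay I _ false λ G c → trans (sym (adj-< G a<b)) (≢true⇒false (Consistent.blocked-edge c blocked ¬edge))
  ... | no ¬blocked with forbidden? (forbidden s) a b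
  ... | yes forbidden = stay I _ false λ G c → trans (sym (adj-< G a<b)) (≢true⇒false (Consistent.forbidden-edge c forbidden))
  ... | no ¬forbidden with (t ≤? degree (forbidden s) a) ⊎-dec (t ≤? degree (forbidden s) b)
  ... | yes heavy = join s I a<b ¬blocked ¬forbidden heavy
  ... | no light = record
    { bit = false ; next = next ; invariant = invariant ; growth = ≤-refl
    ; refines = λ G c → refines G c , trans (sym (adj-< G a<b)) (≢true⇒false (Consistent.forbidden-edge c forbidden-ab)) }
    where open Forbid s I (λ a≡b → <-irrefl (cong toℕ a≡b) a<b) ¬edge (light ∘ inj₁) (light ∘ inj₂)

  initial : State
  initial = ⟨ map [_] (allFin n) , [] ⟩

  initial-invariant : Invariant initial
  initial-invariant = record
    { partition = ↭.↭-reflexive (concat-singletons (allFin n))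
    ; nonEmpty = All-singletons (λ _ → s≤s z≤n) (allFin n)
    ; covered = All-singletons (λ { _ (there ()) }) (allFin n)
    ; degree≤ = λ _ → z≤n
    ; forbidden-apart = λ { (inj₁ ()) ; (inj₂ ()) }
    ; forbidden-irrefl = λ () }
    where
    concat-singletons : ∀ (xs : List V) → concat (map [_] xs) ≡ xs
    concat-singletons [] = refl
    concat-singletons (x ∷ xs) = cong (x ∷_) (concat-singletons xs)
    All-singletons : ∀ {P : List V → Set} → (∀ x → P [ x ]) → ∀ xs → All P (map [_] xs)
    All-singletons p [] = []
    All-singletons p (x ∷ xs) = p x ∷ All-singletons p xs

  record Outcome (T : DTree (Edge n)) (s : State) : Set where
    field
      final     : State
      invariant : Invariant final
      growth    : length (forbidden final) ≤ length (forbidden s) + depth T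
      refines   : ∀ G → Consistent G final → Consistent G s
      constant  : ∀ G₁ G₂ → Consistent G₁ final → Consistent G₂ final → eval T G₁ ≡ eval T G₂

  eval-node : ∀ {Q : Set} q (l r : DTree Q) x {β} → x q ≡ β → eval (node q l r) x ≡ eval (if β then r else l) x
  eval-node q l r x {false} e rewrite e = refl
  eval-node q l r x {true} e rewrite e = refl

  descend : ∀ {q l r s} (ans : Answer s q) → let sub = if Answer.bit ans then r else l in
            depth sub ≤ depth l ⊔ depth r → Outcome sub (Answer.next ans) → Outcome (node q l r) s
  descend {q} {l} {r} {s} ans sub≤ out = record
    { final = final ; invariant = invariant
    ; growth = ≤-trans growth (≤-trans (+-mono-≤ (Answer.growth ans) sub≤) (≤-reflexive (sym (+-suc _ _))))
    ; refines = λ G c → proj₁ (back G c)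
    ; constant = λ G₁ G₂ c₁ c₂ → trans (eval-node q l r G₁ (proj₂ (back G₁ c₁)))
                                   (trans (constant G₁ G₂ c₁ c₂) (sym (eval-node q l r G₂ (proj₂ (back G₂ c₂))))) }
    where
    open Outcome out
    back : ∀ G → Consistent G final → Consistent G s × G q ≡ Answer.bit ans
    back G c = Answer.refines ans G (refines G c)

  run : ∀ T s → Invariant s → Outcome T s
  run (leaf β) s I = record
    { final = s ; invariant = I ; growth = m≤m+n _ 0 ; refines = λ _ c → c ; constant = λ _ _ _ _ → refl }
  run (node q l r) s I with answer s I q
  ... | ans@record { bit = false } = descend ans (m≤m⊔n _ _) (run l _ (Answer.invariant ans))
  ... | ans@record { bit = true } = descend ans (m≤n⊔m _ _) (run r _ (Answer.invariant ans))

  -- Forbidden degrees and the weight of a state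

  OtherEnd : V → V × V → V → Set
  OtherEnd v e x = (v , x) ≡ e ⊎ (x , v) ≡ e

  forbidden-count≤degree : ∀ F v {xs} → Unique xs → count (forbidden? F v) xs ≤ degree F v
  forbidden-count≤degree [] v {xs} _ =
    ≤-reflexive (count-none (forbidden? [] v) (All.universal (λ { _ (inj₁ ()) ; _ (inj₂ ()) }) xs))
  forbidden-count≤degree (e ∷ F) v {xs} u =
    ≤-trans (count-⊎ (forbidden? (e ∷ F) v) (otherEnd? e) (forbidden? F v) split xs)
            (+-mono-≤ (otherEnds≤ (incident? v e)) (forbidden-count≤degree F v u))
    where
    otherEnd? : ∀ e x → Dec (OtherEnd v e x)
    otherEnd? e x = ≡-dec Fin._≟_ Fin._≟_ (v , x) e ⊎-dec ≡-dec Fin._≟_ Fin._≟_ (x , v) e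
    split : ∀ {x} → Forbidden (e ∷ F) v x → OtherEnd v e x ⊎ Forbidden F v x
    split (inj₁ (here ≡e)) = inj₁ (inj₁ ≡e)
    split (inj₁ (there ∈F)) = inj₂ (inj₁ ∈F)
    split (inj₂ (here ≡e)) = inj₁ (inj₂ ≡e)
    split (inj₂ (there ∈F)) = inj₂ (inj₂ ∈F)
    otherEnds≤ : (i : Dec (Incident v e)) → count (otherEnd? e) xs ≤ indicator i
    otherEnds≤ (no ¬i) =
      ≤-reflexive (count-none (otherEnd? e) (All.universal (λ { _ (inj₁ refl) → ¬i (inj₁ refl) ; _ (inj₂ refl) → ¬i (inj₂ refl) }) xs))
    otherEnds≤ (yes (inj₁ refl)) = count-unique≤1 (otherEnd? e) (λ { (inj₁ refl) → refl ; (inj₂ refl) → refl }) u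
    otherEnds≤ (yes (inj₂ refl)) = count-unique≤1 (otherEnd? e) (λ { (inj₁ refl) → refl ; (inj₂ refl) → refl }) u

  sum-degree : ∀ F {vs} → Unique vs → sumOf (degree F) vs ≤ 2 * length F
  sum-degree [] {vs} _ = ≤-reflexive (sumOf-zero vs)
    where
    sumOf-zero : ∀ vs → sumOf (degree []) vs ≡ 0
    sumOf-zero [] = refl
    sumOf-zero (_ ∷ vs) = sumOf-zero vs
  sum-degree (e@(a , b) ∷ F) {vs} u = begin
    sumOf (degree (e ∷ F)) vs                                        ≡⟨ sumOf-+ (λ v → indicator (incident? v e)) (degree F) vs ⟩
    sumOf (λ v → indicator (incident? v e)) vs + sumOf (degree F) vs ≡⟨ cong (_+ _) (sumOf-indicator (λ v → incident? v e) vs) ⟩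
    count (λ v → incident? v e) vs + sumOf (degree F) vs             ≤⟨ +-mono-≤ ends≤2 (sum-degree F u) ⟩
    2 + 2 * length F                                                 ≡⟨ sym (*-suc 2 (length F)) ⟩
    2 * length (e ∷ F)                                               ∎
    where
    open ≤-Reasoning
    ends≤2 : count (λ v → incident? v e) vs ≤ 2
    ends≤2 = ≤-trans (count-⊎ (λ v → incident? v e) (Fin._≟ a) (Fin._≟ b) (λ i → i) vs)
                     (+-mono-≤ (count-unique≤1 (Fin._≟ a) (λ e → e) u) (count-unique≤1 (Fin._≟ b) (λ e → e) u))

  heavy? : ∀ F v → Dec (Heavy F v)
  heavy? F v = t ≤? degree F v

  *-heavy≤ : ∀ F → t * count (heavy? F) (allFin n) ≤ 2 * length F
  *-heavy≤ F = ≤-trans (*-count≤sumOf (heavy? F) t (degree F) (λ h → h) (allFin n)) (sum-degree F (allFin⁺ n))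

  length≤2*heavy+1 : ∀ F X → NonEmpty X → Covered (Heavy F) X →
                     length X ≤ 2 * count (heavy? F) X + 1 × (Heavy F (headOr d X) → length X ≤ 2 * count (heavy? F) X)
  length≤2*heavy+1 F (x ∷ []) _ cov with heavy? F x
  ... | yes _ = s≤s z≤n , (λ _ → s≤s z≤n)
  ... | no ¬h = ≤-refl , (λ h → contradiction h ¬h)
  length≤2*heavy+1 F (x ∷ y ∷ X) _ cov with length≤2*heavy+1 F (y ∷ X) (s≤s z≤n) (cov ∘ there) | heavy? F x
  ... | bound , bound-heavy | yes _ = ≤-trans bound′ (m≤m+n _ 1) , (λ _ → bound′)
    where
    c = count (heavy? F) (y ∷ X)
    bound′ : suc (length (y ∷ X)) ≤ 2 * (1 + c)
    bound′ = ≤-trans (s≤s bound) (≤-reflexive (trans (cong suc (+-comm (2 * c) 1)) (sym (*-suc 2 c))))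
  ... | _ , bound-heavy | no ¬hx =
    ≤-trans (s≤s (bound-heavy heavy-y)) (≤-reflexive (+-comm 1 _)) , (λ hx → contradiction hx ¬hx)
    where
    heavy-y : Heavy F y
    heavy-y = Data.Sum.[ (λ hx → contradiction hx ¬hx) , (λ hy → hy) ]′ (cov here)

  length≤3*heavy : ∀ F X → NonEmpty X → Covered (Heavy F) X → length X ≢ 1 → length X ≤ 3 * count (heavy? F) X
  length≤3*heavy F X ne cov ≢1 with count (heavy? F) X in eq | length≤2*heavy+1 F X ne cov
  ... | zero | bound , _ = contradiction (≤-antisym bound ne) ≢1
  ... | suc c | bound , _ = ≤-trans bound (≤-trans (≤-reflexive (+-comm (2 * suc c) 1)) (+-monoˡ-≤ (2 * suc c) (s≤s z≤n)))

  Singleton : List V → Set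
  Singleton X = length X ≡ 1

  singleton? : ∀ X → Dec (Singleton X)
  singleton? X = length X ℕ.≟ 1

  weight : State → ℕ
  weight s = length (concat (filter (∁? singleton?) (paths s)))

  weight≤ : ∀ F Ps → All NonEmpty Ps → All (Covered (Heavy F)) Ps → All (∁ Singleton) Ps →
            length (concat Ps) ≤ 3 * count (heavy? F) (concat Ps)
  weight≤ F [] _ _ _ = z≤n
  weight≤ F (X ∷ Ps) (ne ∷ nes) (cov ∷ covs) (≢1 ∷ ≢1s) = begin
    length (X ++ concat Ps)                                         ≡⟨ Listₚ.length-++ X ⟩
    length X + length (concat Ps)                                   ≤⟨ +-mono-≤ (length≤3*heavy F X ne cov ≢1) (weight≤ F Ps nes covs ≢1s) ⟩
    3 * count (heavy? F) X + 3 * count (heavy? F) (concat Ps)      ≡⟨ sym (*-distribˡ-+ 3 (count (heavy? F) X) _) ⟩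
    3 * (count (heavy? F) X + count (heavy? F) (concat Ps))        ≡⟨ cong (3 *_) (sym (count-++ (heavy? F) X (concat Ps))) ⟩
    3 * count (heavy? F) (X ++ concat Ps)                           ∎
    where open ≤-Reasoning

  *-weight≤ : ∀ {s} → Invariant s → t * weight s ≤ 6 * length (forbidden s)
  *-weight≤ {s} I = begin
    t * weight s                                         ≤⟨ *-monoʳ-≤ t (weight≤ F Long (keep nonEmpty) (keep covered) (Allₚ.all-filter (∁? singleton?) Ps)) ⟩
    t * (3 * count (heavy? F) (concat Long))             ≤⟨ *-monoʳ-≤ t (*-monoʳ-≤ 3 long⊆all) ⟩
    t * (3 * count (heavy? F) (allFin n))                ≡⟨ *-exchange t 3 _ ⟩
    3 * (t * count (heavy? F) (allFin n))                ≤⟨ *-monoʳ-≤ 3 (*-heavy≤ F) ⟩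
    3 * (2 * length F)                                   ≡⟨ sym (*-assoc 3 2 (length F)) ⟩
    6 * length F                                         ∎
    where
    open ≤-Reasoning
    open Invariant I
    Ps = paths s
    F = forbidden s
    Short = filter singleton? Ps
    Long = filter (∁? singleton?) Ps
    split : Ps ↭ Short ++ Long
    split = ↭-filter-split singleton? Ps
    keep : ∀ {P : List V → Set} → All P Ps → All P Long
    keep ps = Allₚ.++⁻ʳ Short (↭ₚ.All-resp-↭ split ps)
    long⊆all : count (heavy? F) (concat Long) ≤ count (heavy? F) (allFin n)
    long⊆all = begin
      count (heavy? F) (concat Long)                                ≤⟨ m≤n+m _ _ ⟩
      count (heavy? F) (concat Short) + count (heavy? F) (concat Long) ≡⟨ sym (count-++ (heavy? F) (concat Short) (concat Long)) ⟩
      count (heavy? F) (concat Short ++ concat Long)                ≡⟨ cong (count (heavy? F)) (Listₚ.concat-++ Short Long) ⟩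
      count (heavy? F) (concat (Short ++ Long))                     ≡⟨ count-↭ (heavy? F) (concat-↭ (↭-sym split)) ⟩
      count (heavy? F) (concat Ps)                                  ≡⟨ count-↭ (heavy? F) partition ⟩
      count (heavy? F) (allFin n)                                   ∎

  -- Completing the final paths to one or two cycles

  length≤length-concat : ∀ {Ps : List (List V)} → All NonEmpty Ps → length Ps ≤ length (concat Ps)
  length≤length-concat [] = z≤n
  length≤length-concat {X ∷ Ps} (neX ∷ ne) =
    ≤-trans (+-mono-≤ neX (length≤length-concat ne)) (≤-reflexive (sym (Listₚ.length-++ X)))

  record CyclicArrangement (s : State) (Cs : List (List V)) : Set where
    field
      linked   : ∀ {X Y} → Consec (closeCycle Cs) X Y → ¬ Forbidden (forbidden s) (lastOr d X) (headOr d Y)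
      members  : ∀ {X} → X ∈ Cs → X ∈ paths s
      disjoint : DisjointPaths Cs
      several  : 2 ≤ length Cs

    several-vertices : 2 ≤ length (concat Cs)
    several-vertices = ≤-trans several (length≤length-concat (proj₂ disjoint))

  gap-unblocked : ∀ {s} → Invariant s → ∀ {X Y} → X ∈ paths s → Y ∈ paths s → X ≢ Y →
                  ¬ Blocked (paths s) (lastOr d X) (headOr d Y)
  gap-unblocked {s} I {X} {Y} X∈ Y∈ X≢Y = Data.Sum.[ last-interior , Data.Sum.[ head-interior , same ]′ ]′
    where
    open Invariant I
    u : Unique (concat (paths s))
    u = unique-vertices I
    last∈ = lastOr∈ d (All.lookup nonEmpty X∈)
    head∈ = headOr∈ d (All.lookup nonEmpty Y∈)
    last-interior : ¬ Any (λ Z → Interior Z (lastOr d X)) (paths s)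
    last-interior i with find i
    ... | Z , Z∈ , (_ , pred) , succ with same-path u Z∈ X∈ (proj₂ (Consec-∈ pred)) last∈
    ... | refl = last-no-succ d (Unique-member d u X∈) succ
    head-interior : ¬ Any (λ Z → Interior Z (headOr d Y)) (paths s)
    head-interior i with find i
    ... | Z , Z∈ , pred , (_ , succ) with same-path u Z∈ Y∈ (proj₁ (Consec-∈ succ)) head∈
    ... | refl = head-no-pred d (Unique-member d u Y∈) pred
    same : ¬ Any (λ Z → lastOr d X ∈ Z × headOr d Y ∈ Z) (paths s)
    same sp with find sp
    ... | Z , Z∈ , (x∈ , y∈) = X≢Y (trans (sym (same-path u Z∈ X∈ x∈ last∈)) (same-path u Z∈ Y∈ y∈ head∈))

  module _ {s} (I : Invariant s) {Cs} (C : CyclicArrangement s Cs) where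
    open CyclicArrangement C

    arrangement-edge⁻ : ∀ {x y} → CycleAdj (concat Cs) x y →
                        PathEdge (paths s) x y ⊎ (¬ Blocked (paths s) x y × ¬ Forbidden (forbidden s) x y)
    arrangement-edge⁻ (inj₁ c) with Consec-closeCycle-concat⁻ d (proj₂ disjoint) c
    ... | inj₁ (X , X∈ , cX) = inj₁ (lose (members X∈) (inj₁ cX))
    ... | inj₂ (X , Y , cXY , refl , refl) =
      inj₂ (gap-unblocked I (members X∈) (members Y∈) X≢Y , linked cXY)
      where
      X≢Y : X ≢ Y
      X≢Y refl = CycleAdj-irreflexive (Unique-paths d disjoint) several (inj₁ cXY)
      X∈ = closeCycle-∈ (proj₁ (Consec-∈ cXY))
      Y∈ = closeCycle-∈ (proj₂ (Consec-∈ cXY))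
    arrangement-edge⁻ (inj₂ c) =
      Data.Sum.map PathEdge-sym (Data.Product.map (_∘ Blocked-sym) (_∘ Forbidden-sym)) (arrangement-edge⁻ (inj₁ c))

    arrangement-edge⁺ : ∀ {X x y} → X ∈ Cs → Adjacent X x y → CycleAdj (concat Cs) x y
    arrangement-edge⁺ {X} X∈ = Data.Sum.map lift lift
      where
      lift : ∀ {x y} → Consec X x y → Consec (closeCycle (concat Cs)) x y
      lift = Consec-closeCycle-concat⁺ d (proj₂ disjoint) X∈

  consistent : ∀ {s} → Invariant s → ∀ G {R : V → V → Set} → (∀ a b → (adj G a b ≡ true) ⇔ R a b) →
               (∀ {a b} → PathEdge (paths s) a b → R a b) →
               (∀ {a b} → R a b → PathEdge (paths s) a b ⊎ (¬ Blocked (paths s) a b × ¬ Forbidden (forbidden s) a b)) →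
               Consistent G s
  consistent I G adj⇔ path⇒R R⇒ = record
    { path-edge = λ {a} {b} e → Equivalence.from (adj⇔ a b) (path⇒R e)
    ; blocked-edge = λ {a} {b} bl ¬e e → Data.Sum.[ ¬e , (λ (¬bl , _) → ¬bl bl) ]′ (R⇒ (Equivalence.to (adj⇔ a b) e))
    ; forbidden-edge = λ {a} {b} f e →
        Data.Sum.[ Invariant.forbidden-apart I f , (λ (_ , ¬f) → ¬f f) ]′ (R⇒ (Equivalence.to (adj⇔ a b) e)) }

  consistent-cycleGraph : ∀ {s} → Invariant s → ∀ {Cs} → CyclicArrangement s Cs → (∀ {X} → X ∈ paths s → X ∈ Cs) →
                          Consistent (cycleGraph (concat Cs)) s
  consistent-cycleGraph I {Cs} C all =
    consistent I _ (adj-cycleGraph (proj₁ disjoint) several-vertices)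
      (λ e → let X , X∈ , adjX = find e in arrangement-edge⁺ I C (all X∈) adjX)
      (arrangement-edge⁻ I C)
    where open CyclicArrangement C

  consistent-twoCycleGraph : ∀ {s} → Invariant s → ∀ {C₁ C₂} → CyclicArrangement s C₁ → CyclicArrangement s C₂ →
                             (∀ {X} → X ∈ paths s → X ∈ C₁ ⊎ X ∈ C₂) → Unique (concat C₁ ++ concat C₂) →
                             Consistent (twoCycleGraph (concat C₁) (concat C₂)) s
  consistent-twoCycleGraph I {C₁} {C₂} A₁ A₂ all u =
    consistent I _ (adj-twoCycleGraph u (A₁.several-vertices) (A₂.several-vertices))
      (λ e → let X , X∈ , adjX = find e in
               Data.Sum.map (λ X∈₁ → arrangement-edge⁺ I A₁ X∈₁ adjX) (λ X∈₂ → arrangement-edge⁺ I A₂ X∈₂ adjX)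
                            (all X∈))
      Data.Sum.[ arrangement-edge⁻ I A₁ , arrangement-edge⁻ I A₂ ]′
    where
    module A₁ = CyclicArrangement A₁
    module A₂ = CyclicArrangement A₂

  module _ {s} (I : Invariant s) where
    open Invariant I
    open Linking d (forbidden? (forbidden s)) Forbidden-sym t (λ v u → ≤-trans (forbidden-count≤degree _ v u) (degree≤ v))

    arrange : ∀ X Rest → Singleton X → (∀ {Y} → Y ∈ X ∷ Rest → Y ∈ paths s) → DisjointPaths (X ∷ Rest) →
              1 ≤ length Rest → (t + t) + (t + t) ≤ length Rest →
              Σ[ Cs ∈ List (List V) ] (CyclicArrangement s Cs × Cs ↭ X ∷ Rest)
    arrange X@(x ∷ []) Rest refl members ps nonempty size with link-cycle X Rest ps irrefl size
      where
      irrefl : ¬ Forbidden (forbidden s) x x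
      irrefl = Data.Sum.[ (λ f → forbidden-irrefl f refl) , (λ f → forbidden-irrefl f refl) ]′
    ... | Zs , chain , p = X ∷ Zs , arrangement , ↭.prep X p
      where
      arrangement : CyclicArrangement s (X ∷ Zs)
      arrangement = record
        { linked = Chain⇒Linkable chain
        ; members = members ∘ ↭ₚ.∈-resp-↭ (↭.prep X p)
        ; disjoint = DisjointPaths-↭ (↭-sym (↭.prep X p)) ps
        ; several = s≤s (subst (1 ≤_) (sym (↭ₚ.↭-length p)) nonempty) }

    private
      Ps = paths s
      Short = filter singleton? Ps
      Long = filter (∁? singleton?) Ps

      short-long : Ps ↭ Short ++ Long
      short-long = ↭-filter-split singleton? Ps

    length-concat-singletons : ∀ {Xs} → All Singleton Xs → length (concat Xs) ≡ length Xs
    length-concat-singletons [] = refl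
    length-concat-singletons {(_ ∷ []) ∷ Xs} (refl ∷ ss) = cong suc (length-concat-singletons ss)

    singletons+weight : length Short + weight s ≡ n
    singletons+weight = begin
      length Short + weight s                       ≡⟨ cong (_+ weight s) (sym (length-concat-singletons (Allₚ.all-filter singleton? Ps))) ⟩
      length (concat Short) + length (concat Long)  ≡⟨ sym (Listₚ.length-++ (concat Short)) ⟩
      length (concat Short ++ concat Long)          ≡⟨ cong length (Listₚ.concat-++ Short Long) ⟩
      length (concat (Short ++ Long))               ≡⟨ ↭ₚ.↭-length (↭.trans (concat-↭ (↭-sym short-long)) partition) ⟩
      length (allFin n)                             ≡⟨ Listₚ.length-tabulate (λ i → i) ⟩
      n                                             ∎
      where open ≡-Reasoning

    record BalancedSplit (m : ℕ) : Set where
      field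
        headA headB : List V
        restA restB : List (List V)
        singletonA  : Singleton headA
        singletonB  : Singleton headB
        reorder     : (headA ∷ restA) ++ (headB ∷ restB) ↭ Ps
        sizeA       : length (concat (headA ∷ restA)) ≡ m
        sizeB       : length (concat (headB ∷ restB)) ≡ m
        manyA       : (t + t) + (t + t) ≤ length restA
        manyB       : (t + t) + (t + t) ≤ length restB

    balanced-split : ∀ {m} → n ≡ m + m → weight s + suc ((t + t) + (t + t)) ≤ m → BalancedSplit m
    balanced-split {m} n≡m+m room =
      split (take k Short) (drop k Short) (Listₚ.take++drop≡id k Short)
            (trans (Listₚ.length-take k Short) (m≤n⇒m⊓n≡m (subst (k ≤_) (sym |Short|) (m≤m+n k m))))
            (trans (Listₚ.length-drop k Short) (trans (cong (_∸ k) |Short|) (m+n∸m≡n k m)))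
      where
      W = weight s
      k = m ∸ W
      k+W : k + W ≡ m
      k+W = m∸n+n≡m (≤-trans (m≤m+n W _) room)
      |Short| : length Short ≡ k + m
      |Short| = +-cancelʳ-≡ W (length Short) (k + m) (begin
        length Short + W  ≡⟨ singletons+weight ⟩
        n                 ≡⟨ n≡m+m ⟩
        m + m             ≡⟨ cong (_+ m) (sym k+W) ⟩
        k + W + m         ≡⟨ +-assoc k W m ⟩
        k + (W + m)       ≡⟨ cong (k +_) (+-comm W m) ⟩
        k + (m + W)       ≡⟨ sym (+-assoc k m W) ⟩
        k + m + W         ∎)
        where open ≡-Reasoning
      k-room : suc ((t + t) + (t + t)) ≤ k
      k-room = +-cancelˡ-≤ W _ k (subst (W + suc ((t + t) + (t + t)) ≤_) (trans (sym k+W) (+-comm k W)) room)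
      m-room : suc ((t + t) + (t + t)) ≤ m
      m-room = ≤-trans (m≤n+m _ W) room
      split : ∀ T D → T ++ D ≡ Short → length T ≡ k → length D ≡ m → BalancedSplit m
      split [] _ _ |T| _ = contradiction (subst (suc ((t + t) + (t + t)) ≤_) (sym |T|) k-room) λ ()
      split (_ ∷ _) [] _ _ |D| = contradiction (subst (suc ((t + t) + (t + t)) ≤_) (sym |D|) m-room) λ ()
      split T@(hA ∷ rA) D@(hB ∷ rB) T++D |T| |D| = record
        { headA = hA ; headB = hB ; restA = rA ++ Long ; restB = rB
        ; singletonA = All.lookup singleT (here refl)
        ; singletonB = All.lookup singleD (here refl)
        ; reorder = ↭.trans (↭.↭-reflexive (Listₚ.++-assoc T Long D))
                      (↭.trans (↭ₚ.++⁺ˡ T (↭ₚ.++-comm Long D))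
                        (↭.trans (↭.↭-reflexive (trans (sym (Listₚ.++-assoc T D Long)) (cong (_++ Long) T++D)))
                          (↭-sym short-long)))
        ; sizeA = begin
            length (concat (T ++ Long))            ≡⟨ cong length (sym (Listₚ.concat-++ T Long)) ⟩
            length (concat T ++ concat Long)       ≡⟨ Listₚ.length-++ (concat T) ⟩
            length (concat T) + W                  ≡⟨ cong (_+ W) (trans (length-concat-singletons singleT) |T|) ⟩
            k + W                                  ≡⟨ k+W ⟩
            m                                      ∎
        ; sizeB = trans (length-concat-singletons singleD) |D|
        ; manyA = ≤-trans (s≤s⁻¹ (subst (suc ((t + t) + (t + t)) ≤_) (sym |T|) k-room)) (Listₚ.length-++-≤ˡ rA)
        ; manyB = s≤s⁻¹ (subst (suc ((t + t) + (t + t)) ≤_) (sym |D|) m-room) }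
        where
        open ≡-Reasoning
        singleTD : All Singleton (T ++ D)
        singleTD = subst (All Singleton) (sym T++D) (Allₚ.all-filter singleton? Ps)
        singleT = Allₚ.++⁻ˡ T singleTD
        singleD = Allₚ.++⁻ʳ T singleTD

    two-extensions : ∀ {m} → 1 ≤ t → n ≡ m + m → 2 ≤ m → weight s + suc ((t + t) + (t + t)) ≤ m →
                     Σ[ G₁ ∈ Graph n ] Σ[ G₂ ∈ Graph n ]
                       (IsOneCycle G₁ × IsTwoCycles m G₂ × Consistent G₁ s × Consistent G₂ s)
    two-extensions {m} t≥1 n≡m+m m≥2 room with balanced-split n≡m+m room
    ... | record { headA = hA ; headB = hB ; restA = rA ; restB = rB ; singletonA = sA ; singletonB = sB
                 ; reorder = reorder ; sizeA = sizeA ; sizeB = sizeB ; manyA = manyA ; manyB = manyB }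
      with arrange hA (rA ++ hB ∷ rB) sA members disjointAB (nonempty many) many
         | arrange hA rA sA (members ∘ ∈-++⁺ˡ) disjointA (nonempty manyA) manyA
         | arrange hB rB sB (members ∘ ∈-++⁺ʳ (hA ∷ rA)) disjointB (nonempty manyB) manyB
      where
      members : ∀ {Y} → Y ∈ (hA ∷ rA) ++ (hB ∷ rB) → Y ∈ Ps
      members = ↭ₚ.∈-resp-↭ reorder
      disjointAB : DisjointPaths ((hA ∷ rA) ++ (hB ∷ rB))
      disjointAB = DisjointPaths-↭ (↭-sym reorder) (unique-vertices I , nonEmpty)
      disjointA = proj₁ (DisjointPaths-++⁻ (hA ∷ rA) disjointAB)
      disjointB = proj₂ (DisjointPaths-++⁻ (hA ∷ rA) disjointAB)
      nonempty : ∀ {l} → (t + t) + (t + t) ≤ l → 1 ≤ l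
      nonempty = ≤-trans (≤-trans t≥1 (≤-trans (m≤m+n t t) (m≤m+n (t + t) (t + t))))
      many : (t + t) + (t + t) ≤ length (rA ++ hB ∷ rB)
      many = ≤-trans manyA (Listₚ.length-++-≤ˡ rA)
    ... | C , arrangement , C↭ | C₁ , arrangement₁ , C₁↭ | C₂ , arrangement₂ , C₂↭ =
      cycleGraph (concat C) , twoCycleGraph (concat C₁) (concat C₂) ,
      isOneCycle-cycleGraph (concat C) |C| (proj₁ (CyclicArrangement.disjoint arrangement)) n≥2 ,
      isTwoCycles-twoCycleGraph (concat C₁) (concat C₂) |C₁| |C₂| n≡m+m unique₁₂ m≥2 ,
      consistent-cycleGraph I arrangement (↭ₚ.∈-resp-↭ (↭-sym (↭.trans C↭ reorder))) ,
      consistent-twoCycleGraph I arrangement₁ arrangement₂ cover unique₁₂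
      where
      n≥2 : 2 ≤ n
      n≥2 = subst (2 ≤_) (sym n≡m+m) (≤-trans m≥2 (m≤m+n m m))
      |C| : length (concat C) ≡ n
      |C| = trans (↭ₚ.↭-length (↭.trans (concat-↭ (↭.trans C↭ reorder)) partition)) (Listₚ.length-tabulate (λ i → i))
      |C₁| : length (concat C₁) ≡ m
      |C₁| = trans (↭ₚ.↭-length (concat-↭ C₁↭)) sizeA
      |C₂| : length (concat C₂) ≡ m
      |C₂| = trans (↭ₚ.↭-length (concat-↭ C₂↭)) sizeB
      C₁₂↭ : C₁ ++ C₂ ↭ Ps
      C₁₂↭ = ↭.trans (↭ₚ.++⁺ C₁↭ C₂↭) reorder
      unique₁₂ : Unique (concat C₁ ++ concat C₂)
      unique₁₂ = subst Unique (sym (Listₚ.concat-++ C₁ C₂)) (Unique-resp-↭ (↭-sym (concat-↭ C₁₂↭)) (unique-vertices I))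
      cover : ∀ {X} → X ∈ Ps → X ∈ C₁ ⊎ X ∈ C₂
      cover = ∈-++⁻ C₁ ∘ ↭ₚ.∈-resp-↭ (↭-sym C₁₂↭)

distrib-room : ∀ t w → t * (w + suc ((t + t) + (t + t))) ≡ t * w + t * (4 * t + 1)
distrib-room = solve-∀

threshold-large : ∀ D r t → r ≤ 7 → 2 ≤ t → 128 * D < (r + t * 8) * (r + t * 8) →
                  6 * D + t * (4 * t + 1) ≤ t * (r + t * 8)
threshold-large D r t r≤7 t≥2 lt = *-cancelˡ-≤ 64 (begin
    64 * (6 * D + t * (4 * t + 1))             ≡⟨ expand-goal D t ⟩
    384 * D + 256 * (t * t) + 64 * t            ≤⟨ +-monoˡ-≤ (64 * t) (+-monoˡ-≤ (256 * (t * t)) (m≤m+n (384 * D) 3)) ⟩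
    (384 * D + 3) + 256 * (t * t) + 64 * t      ≤⟨ +-monoˡ-≤ (64 * t) (+-monoˡ-≤ (256 * (t * t)) square-bound) ⟩
    (192 * (t * t) + 48 * (r * t) + 3 * (r * r)) + 256 * (t * t) + 64 * t
        ≤⟨ +-mono-≤ (+-monoˡ-≤ (256 * (t * t)) (+-monoʳ-≤ (192 * (t * t) + 48 * (r * t)) r²≤)) t≤t² ⟩
    (192 * (t * t) + 48 * (r * t) + 16 * (r * t)) + 256 * (t * t) + 64 * (t * t) ≡⟨ collect r t ⟩
    64 * (t * (r + t * 8))                                               ∎)
  where
  open ≤-Reasoning
  expand-goal : ∀ D t → 64 * (6 * D + t * (4 * t + 1)) ≡ 384 * D + 256 * (t * t) + 64 * t
  expand-goal = solve-∀
  expand-budget : ∀ D → 3 * suc (128 * D) ≡ 384 * D + 3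
  expand-budget = solve-∀
  expand-square : ∀ r t → 3 * ((r + t * 8) * (r + t * 8)) ≡ 192 * (t * t) + 48 * (r * t) + 3 * (r * r)
  expand-square = solve-∀
  collect : ∀ r t → 192 * (t * t) + 48 * (r * t) + 16 * (r * t) + 256 * (t * t) + 64 * (t * t) ≡ 64 * (t * (r + t * 8))
  collect = solve-∀
  square-bound : 384 * D + 3 ≤ 192 * (t * t) + 48 * (r * t) + 3 * (r * r)
  square-bound = subst₂ _≤_ (expand-budget D) (expand-square r t) (*-monoʳ-≤ 3 lt)
  r²≤ : 3 * (r * r) ≤ 16 * (r * t)
  r²≤ = begin
    3 * (r * r)   ≤⟨ *-monoʳ-≤ 3 (*-monoˡ-≤ r r≤7) ⟩
    3 * (7 * r)   ≤⟨ ≤-reflexive (sym (*-assoc 3 7 r)) ⟩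
    21 * r        ≤⟨ *-monoˡ-≤ r (m≤m+n 21 11) ⟩
    32 * r        ≡⟨ *-assoc 16 2 r ⟩
    16 * (2 * r)  ≤⟨ *-monoʳ-≤ 16 (≤-trans (*-monoˡ-≤ r t≥2) (≤-reflexive (*-comm t r))) ⟩
    16 * (r * t)  ∎
  t≤t² : 64 * t ≤ 64 * (t * t)
  t≤t² = *-monoʳ-≤ 64 (m≤m*n t t)
    where instance _ = >-nonZero (≤-trans (s≤s z≤n) t≥2)

-- t = ⌊m/8⌋ balances the room 4t + 1 needed for linking against the weight bound 6D/t.
threshold : ∀ m D → 12 ≤ m → 128 * D < m * m → Σ[ t ∈ ℕ ] (1 ≤ t × 6 * D + t * (4 * t + 1) ≤ t * m)
threshold m D m≥12 lt with m ℕ.<? 16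
... | yes m<16 = 1 , s≤s z≤n , (begin
    6 * D + 5  ≤⟨ +-monoˡ-≤ 5 (*-monoʳ-≤ 6 D≤1) ⟩
    11         ≤⟨ ≤-trans (n≤1+n 11) m≥12 ⟩
    m          ≡⟨ sym (*-identityˡ m) ⟩
    1 * m      ∎)
  where
  open ≤-Reasoning
  D≤1 : D ≤ 1
  D≤1 = ≮⇒≥ λ 1<D → ≤⇒≯ (*-mono-≤ (s≤s⁻¹ m<16) (s≤s⁻¹ m<16))
                          (≤-trans (s≤s (≤-trans (m≤m+n 225 31) (*-monoʳ-≤ 128 1<D))) lt)
... | no m≮16 = t , ≤-trans (s≤s z≤n) t≥2 ,
                subst (λ k → 6 * D + t * (4 * t + 1) ≤ t * k) (sym m≡)
                  (threshold-large D (m % 8) t (s≤s⁻¹ (m%n<n m 8)) t≥2 (subst (λ k → 128 * D < k * k) m≡ lt))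
  where
  t = m / 8
  m≡ : m ≡ m % 8 + t * 8
  m≡ = m≡m%n+[m/n]*n m 8
  t≥2 : 2 ≤ t
  t≥2 = /-monoˡ-≤ 8 (≮⇒≥ m≮16)

leaf-cannot-compute : ∀ {n m} → n ≡ m + m → 2 ≤ m → ∀ {f} → Extends1vs2 m f → ∀ β → ¬ Computes (leaf β) f
leaf-cannot-compute {n} {m} n≡m+m m≥2 (one↦true , two↦false) β computes =
  contradiction (trans (sym (trans (computes _) (one↦true _ one))) (trans (computes _) (two↦false _ two))) λ ()
  where
  |allFin| : length (allFin n) ≡ n
  |allFin| = Listₚ.length-tabulate (λ i → i)
  m≤n : m ≤ n
  m≤n = subst (m ≤_) (sym n≡m+m) (m≤m+n m m)
  one = isOneCycle-cycleGraph (allFin n) |allFin| (allFin⁺ n) (≤-trans m≥2 m≤n)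
  two = isTwoCycles-twoCycleGraph (take m (allFin n)) (drop m (allFin n))
          (trans (Listₚ.length-take m (allFin n)) (m≤n⇒m⊓n≡m (subst (m ≤_) (sym |allFin|) m≤n)))
          (trans (Listₚ.length-drop m (allFin n)) (trans (cong (_∸ m) (trans |allFin| n≡m+m)) (m+n∸m≡n m m)))
          n≡m+m (subst Unique (sym (Listₚ.take++drop≡id m (allFin n))) (allFin⁺ n)) m≥2

Computes⇒depth≥1 : ∀ {n m} → n ≡ m + m → 2 ≤ m → ∀ {f} → Extends1vs2 m f → ∀ T → Computes T f → 1 ≤ depth T
Computes⇒depth≥1 n≡m+m m≥2 extends (leaf β) computes = ⊥-elim (leaf-cannot-compute n≡m+m m≥2 extends β computes)
Computes⇒depth≥1 n≡m+m m≥2 extends (node _ _ _) computes = s≤s z≤n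

adversary-bound : ∀ {n m} → n ≡ m + m → 2 ≤ m → Fin n → ∀ {f} → Extends1vs2 m f → ∀ T → Computes T f →
                  ∀ t → 1 ≤ t → ¬ (6 * depth T + t * (4 * t + 1) ≤ t * m)
adversary-bound {n} {m} n≡m+m m≥2 d (one↦true , two↦false) T computes t t≥1 budget =
  distinguish (two-extensions invariant t≥1 n≡m+m m≥2 room)
  where
  open Adversary n d t
  open Outcome (run T initial initial-invariant)
  room : weight final + suc ((t + t) + (t + t)) ≤ m
  room = *-cancelˡ-≤ t (begin
    t * (weight final + suc ((t + t) + (t + t)))   ≡⟨ distrib-room t (weight final) ⟩
    t * weight final + t * (4 * t + 1)             ≤⟨ +-monoˡ-≤ _ (≤-trans (*-weight≤ invariant) (*-monoʳ-≤ 6 growth)) ⟩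
    6 * depth T + t * (4 * t + 1)                  ≤⟨ budget ⟩
    t * m                                          ∎)
    where
    open ≤-Reasoning
    instance _ = >-nonZero t≥1
  distinguish : Σ[ G₁ ∈ Graph n ] Σ[ G₂ ∈ Graph n ]
                  (IsOneCycle G₁ × IsTwoCycles m G₂ × Consistent G₁ final × Consistent G₂ final) → ⊥
  distinguish (G₁ , G₂ , one , two , consistent₁ , consistent₂) =
    contradiction (trans (sym (trans (computes G₁) (one↦true G₁ one)))
                    (trans (constant G₁ G₂ consistent₁ consistent₂) (trans (computes G₂) (two↦false G₂ two)))) λ ()

half≥2 : ∀ {n m} → n ≡ m + m → 6 ≤ n → 2 ≤ m
half≥2 {m = zero} refl ()
half≥2 {m = suc zero} refl (s≤s (s≤s ()))
half≥2 {m = suc (suc _)} _ _ = s≤s (s≤s z≤n)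

quarter : ∀ {n m} D → n ≡ m + m → 512 * D < n * n → 128 * D < m * m
quarter {m = m} D refl lt = *-cancelˡ-< 4 (128 * D) (m * m) (subst₂ _<_ (*-assoc 4 128 D) (double-square m) lt)
  where
  double-square : ∀ m → (m + m) * (m + m) ≡ 4 * (m * m)
  double-square = solve-∀

≥12 : ∀ {m D} → 1 ≤ D → 128 * D < m * m → 12 ≤ m
≥12 {m} D≥1 lt = ≮⇒≥ λ m<12 → ≤⇒≯ (*-mono-≤ (s≤s⁻¹ m<12) (s≤s⁻¹ m<12))
                                    (≤-trans (s≤s (≤-trans (m≤m+n 121 7) (*-monoʳ-≤ 128 D≥1))) lt)

corollary4p6 : (n m : ℕ) → n ≡ m + m → 6 ≤ n →
    (f : Graph n → Bool) → Extends1vs2 m f →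
    (T : DTree (Edge n)) → Computes T f →
    n * n ≤ 512 * depth T
corollary4p6 n m n≡m+m n≥6 f extends T computes = ≮⇒≥ λ lt →
  let lt′ = quarter {m = m} (depth T) n≡m+m lt
      t , t≥1 , budget = threshold m (depth T) (≥12 (Computes⇒depth≥1 n≡m+m m≥2 extends T computes) lt′) lt′
  in adversary-bound n≡m+m m≥2 (fromℕ< (≤-trans (s≤s z≤n) n≥6)) extends T computes t t≥1 budget
  where
  m≥2 : 2 ≤ m
  m≥2 = half≥2 n≡m+m n≥6
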